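{- Let $\lambda$ be any Young diagram inside the $k\times(n-k)$ rectangle, and let $r_{ij}$, $(i,j)\in\lambda$, be positive integers satisfying $r_{ij}>r_{i,j+1}$ and $r_{ij}>r_{i+1,j}$ (with the convention $r_{ij}=0$ for $(i,j)\notin\lambda$). Let $X_\lambda\in\mathcal H$ be defined from these $r_{ij}$ as in the context, and let $\mathcal L_\lambda=\sum_{\varepsilon\in E}O(v^{r_\lambda(\varepsilon)})\,\varepsilon\subset M$. Then $X_\lambda\cdot\mathbf 1\in\mathcal L_\lambda$.
   Context: For an integer $m$, $O(v^m)$ denotes the set of $f\in\mathbb Q(v)$ with a zero of order $\ge m$ at $v=0$ (i.e. $v^{ -m}f$ regular at $0$). Fix $1\le k\le n-1$. $\mathcal H$ is the Hecke algebra of $S_n$ over $\mathbb Q(v)$ with generators $T_1,\dots,T_{n-1}$, braid relations and $(T_i-v)(T_i+v^{ -1})=0$. $E$ is the set of $\varepsilon\in\{+,-\}^n$ with exactly $k$ pluses; $S_n$ acts by permuting positions, $s_i=(i,i+1)$. $M=\bigoplus_{\varepsilon\in E}\mathbb Q(v)\varepsilon$ with $T_i\varepsilon=s_i\varepsilon$ if $(\varepsilon_i,\varepsilon_{i+1})=(+,-)$; $T_i\varepsilon=-v^{ -1}\varepsilon$ if $(\varepsilon_i,\varepsilon_{i+1})\in\{(-,-),(+,+)\}$; $T_i\varepsilon=s_i\varepsilon+(v-v^{ -1})\varepsilon$ if $(\varepsilon_i,\varepsilon_{i+1})=(-,+)$. $\mathbf 1=(+,\dots,+,-,\dots,-)$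 ($k$ pluses then $n-k$ minuses). A Young diagram in the rectangle is $\lambda=(\lambda_1\ge\dots\ge\lambda_k\ge0)$, $\lambda_1\le n-k$, with boxes $(i,j)$, $1\le j\le\lambda_i$, and $\ell$ nonzero rows. With $[r]=(v^r-v^{ -r})/(v-v^{ -1})$, set $X_\lambda=Y_\ell\cdots Y_1$, $Y_i=\bigl(T_{k+\lambda_i-i}-\tfrac{v^{r_{i,\lambda_i}}}{[r_{i,\lambda_i}]}\bigr)\cdots\bigl(T_{k+1-i}-\tfrac{v^{r_{i,1}}}{[r_{i,1}]}\bigr)$ (factor $T_{k+j-i}-v^{r_{ij}}/[r_{ij}]$ for box $(i,j)$, $j$ decreasing from left to right). Weight: put $a(i)=k+\lambda_i-i+1$ for $i=1,\dots,k$ (so $a(1)>a(2)>\dots>a(k)$, and these are the positions of the pluses of $w_\lambda(\mathbf 1)$, where $w_\lambda=P_\ell\cdots P_1$, $P_i=s_{k+\lambda_i-i}\cdots s_{k+1-i}$). For $\varepsilon\in E$ define $r_\lambda(\varepsilon)=\sum_{t=1}^n r_t(\varepsilon)$, where: (i) if $t=a(i)$ and $\varepsilon_t=-$, then $r_t(\varepsilon)=r_{i,\lambda_i}-1$ (with $r_{i,0}=0$); (ii) if $a(i+1)<t<a(i)$ for some $i$ and $\varepsilon_t=+$, then $r_t(\varepsilon)=r_{ij}$ where $j$ is determined by $k+j-i=t$; (iii) otherwise $r_t(\varepsilon)=0$. -}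

module Defs where

open import Data.Bool using (Bool; true; false; if_then_else_; _∧_; not)
open import Data.Nat as ℕ using (ℕ; zero; suc; _≤_; _<_; _∸_; _≡ᵇ_; _<ᵇ_; _≤ᵇ_)
open import Data.Integer as ℤ using (ℤ; +_)
open import Data.Rational as ℚ using (ℚ; 0ℚ; 1ℚ)
open import Data.List using (List; []; _∷_; map; foldl; upTo)
open import Data.Maybe using (Maybe; just; nothing)
import Data.Maybe as Maybe
open import Data.Vec using (Vec; []; _∷_; tabulate)
open import Data.Fin using (toℕ)
open import Data.Product using (Σ; _×_; _,_)
open import Data.Sum using (_⊎_)
open import Relation.Binary.PropositionalEquality using (_≡_)
open import Relation.Nullary using (yes; no)

-- Polynomials in v over ℚ : coefficient lists, c₀ + c₁ v + c₂ v² + …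

Poly : Set
Poly = List ℚ

addP : Poly → Poly → Poly
addP []       q        = q
addP (a ∷ p)  []       = a ∷ p
addP (a ∷ p)  (b ∷ q)  = (a ℚ.+ b) ∷ addP p q

scaleP : ℚ → Poly → Poly
scaleP c p = map (c ℚ.*_) p

negP : Poly → Poly
negP = map (λ a → ℚ.- a)

mulP : Poly → Poly → Poly
mulP []      q = []
mulP (a ∷ p) q = addP (scaleP a q) (0ℚ ∷ mulP p q)

monoP : ℕ → Poly
monoP zero    = 1ℚ ∷ []
monoP (suc r) = 0ℚ ∷ monoP r

ordP : Poly → Maybe ℕ
ordP []      = nothing
ordP (a ∷ p) with a ℚ.≟ 0ℚ
... | yes _ = Maybe.map suc (ordP p)
... | no  _ = just 0

-- The field ℚ(v): elements represented as fractions num / den of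
-- polynomials (all denominators arising below are nonzero).

record Qv : Set where
  constructor _/ₚ_
  field
    num : Poly
    den : Poly
open Qv public

infixl 6 _+F_ _-F_
infixl 7 _*F_ _÷F_

_+F_ : Qv → Qv → Qv
(a /ₚ b) +F (c /ₚ d) = addP (mulP a d) (mulP c b) /ₚ mulP b d

-F_ : Qv → Qv
-F (a /ₚ b) = negP a /ₚ b

_-F_ : Qv → Qv → Qv
f -F g = f +F (-F g)

_*F_ : Qv → Qv → Qv
(a /ₚ b) *F (c /ₚ d) = mulP a c /ₚ mulP b d

_÷F_ : Qv → Qv → Qv
(a /ₚ b) ÷F (c /ₚ d) = mulP a d /ₚ mulP b c

0F 1F vF v⁻¹F : Qv
0F   = [] /ₚ (1ℚ ∷ [])
1F   = (1ℚ ∷ []) /ₚ (1ℚ ∷ [])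
vF   = monoP 1 /ₚ (1ℚ ∷ [])
v⁻¹F = (1ℚ ∷ []) /ₚ monoP 1

vpow vnegpow : ℕ → Qv
vpow r    = monoP r /ₚ (1ℚ ∷ [])
vnegpow r = (1ℚ ∷ []) /ₚ monoP r

qint : ℕ → Qv
qint r = (vpow r -F vnegpow r) ÷F (vF -F v⁻¹F)

InO : ℤ → Qv → Set
InO m f = (ordP (num f) ≡ nothing)
        ⊎ Σ ℕ (λ a → Σ ℕ (λ b →
            (ordP (num f) ≡ just a) × (ordP (den f) ≡ just b) × (m ℤ.+ + b ℤ.≤ + a)))

-- Sign vectors ε ∈ {+,-}^n  (true = +, false = -), positions 1-indexed.

sgn : ∀ {n} → Vec Bool n → ℕ → Bool
sgn []       _             = false
sgn (x ∷ xs) zero          = false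
sgn (x ∷ xs) (suc zero)    = x
sgn (x ∷ xs) (suc (suc t)) = sgn xs (suc t)

swapAt : ∀ {n} → ℕ → Vec Bool n → Vec Bool n
swapAt (suc zero)    (x ∷ y ∷ xs) = y ∷ x ∷ xs
swapAt (suc (suc i)) (x ∷ xs)     = x ∷ swapAt (suc i) xs
swapAt _             xs           = xs

countPlus : ∀ {n} → Vec Bool n → ℕ
countPlus []           = 0
countPlus (true ∷ xs)  = suc (countPlus xs)
countPlus (false ∷ xs) = countPlus xs

InE : (n k : ℕ) → Vec Bool n → Set
InE n k ε = countPlus ε ≡ k

eqVec : ∀ {n} → Vec Bool n → Vec Bool n → Bool
eqVec []       []       = true
eqVec (x ∷ xs) (y ∷ ys) = (if x then y else not y) ∧ eqVec xs ys

-- The module M: elements are coefficient functions ε ↦ (coefficient of ε)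

M : ℕ → Set
M n = Vec Bool n → Qv

_+M_ : ∀ {n} → M n → M n → M n
(x +M y) η = x η +F y η

_·M_ : ∀ {n} → Qv → M n → M n
(c ·M x) η = c *F x η

-- action of T_i on M, written coordinatewise (dual to the formulas on basis vectors):
--   T_i ε = s_i ε                     if (ε_i,ε_{i+1}) = (+,-)
--   T_i ε = -v⁻¹ ε                    if ε_i = ε_{i+1}
--   T_i ε = s_i ε + (v - v⁻¹) ε       if (ε_i,ε_{i+1}) = (-,+)
T : ∀ {n} → ℕ → M n → M n
T i x η with sgn η i | sgn η (suc i)
... | true  | false = x (swapAt i η)
... | false | true  = x (swapAt i η) +F ((vF -F v⁻¹F) *F x η)
... | true  | true  = (-F v⁻¹F) *F x η
... | false | false = (-F v⁻¹F) *F x η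

oneVec : (n k : ℕ) → Vec Bool n
oneVec n k = tabulate (λ i → toℕ i <ᵇ k)

oneM : (n k : ℕ) → M n
oneM n k η = if eqVec η (oneVec n k) then 1F else 0F

-- Young diagrams in the k × (n-k) rectangle: λ = (λ₁,…,λ_k) as Vec ℕ k

row : ∀ {k} → Vec ℕ k → ℕ → ℕ
row []       _             = 0
row (x ∷ xs) zero          = 0
row (x ∷ xs) (suc zero)    = x
row (x ∷ xs) (suc (suc i)) = row xs (suc i)

IsYoung : (n k : ℕ) → Vec ℕ k → Set
IsYoung n k lam =
  (∀ i → 1 ≤ i → row lam (suc i) ≤ row lam i) × (∀ i → row lam i ≤ n ∸ k)

InBox : ∀ {k} → Vec ℕ k → ℕ → ℕ → Set
InBox {k} lam i j = (1 ≤ i) × (i ≤ k) × (1 ≤ j) × (j ≤ row lam i)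

inBoxᵇ : ∀ {k} → Vec ℕ k → ℕ → ℕ → Bool
inBoxᵇ {k} lam i j = (1 ≤ᵇ i) ∧ (i ≤ᵇ k) ∧ (1 ≤ᵇ j) ∧ (j ≤ᵇ row lam i)

rr : ∀ {k} → Vec ℕ k → (ℕ → ℕ → ℕ) → ℕ → ℕ → ℕ
rr lam r i j = if inBoxᵇ lam i j then r i j else 0

Admissible : ∀ {k} → Vec ℕ k → (ℕ → ℕ → ℕ) → Set
Admissible lam r = ∀ i j → InBox lam i j →
  (0 < r i j) × (rr lam r i (suc j) < r i j) × (rr lam r (suc i) j < r i j)

oneTo : ℕ → List ℕ
oneTo m = map suc (upTo m)

boxFactor : ∀ {n} (k : ℕ) → Vec ℕ k → (ℕ → ℕ → ℕ) → ℕ → ℕ → M n → M n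
boxFactor k lam r i j x =
  T ((k ℕ.+ j) ∸ i) x +M ((-F (vpow (rr lam r i j) ÷F qint (rr lam r i j))) ·M x)

-- Y_i · x : factors for (i,1) applied first, then (i,2), …, (i,λ_i)
rowAct : ∀ {n} (k : ℕ) → Vec ℕ k → (ℕ → ℕ → ℕ) → ℕ → M n → M n
rowAct k lam r i x = foldl (λ y j → boxFactor k lam r i j y) x (oneTo (row lam i))

-- X_λ · x = Y_ℓ ⋯ Y_1 · x  (rows with λ_i = 0 contribute the identity)
XAct : ∀ {n} (k : ℕ) → Vec ℕ k → (ℕ → ℕ → ℕ) → M n → M n
XAct k lam r x = foldl (λ y i → rowAct k lam r i y) x (oneTo k)

aPos : ∀ {k} → Vec ℕ k → ℕ → ℕ
aPos {k} lam i = if i ≤ᵇ k then (k ℕ.+ row lam i ℕ.+ 1) ∸ i else 0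

pick : List (Maybe ℤ) → ℤ
pick []             = + 0
pick (just z ∷ _)   = z
pick (nothing ∷ zs) = pick zs

rt : ∀ {n k} → Vec ℕ k → (ℕ → ℕ → ℕ) → Vec Bool n → ℕ → ℤ
rt {n} {k} lam r ε t = pick (map caseI (oneTo k))
  where
  caseI : ℕ → Maybe ℤ
  caseI i =
    if (t ≡ᵇ aPos lam i) ∧ not (sgn ε t)
      then just (+ rr lam r i (row lam i) ℤ.- + 1)
      else (if (aPos lam (suc i) <ᵇ t) ∧ (t <ᵇ aPos lam i) ∧ sgn ε t
              then just (+ rr lam r i ((t ℕ.+ i) ∸ k))
              else nothing)

sumℤ : List ℤ → ℤ
sumℤ []       = + 0
sumℤ (z ∷ zs) = z ℤ.+ sumℤ zs

weight : ∀ {n k} → Vec ℕ k → (ℕ → ℕ → ℕ) → Vec Bool n → ℤ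
weight {n} lam r ε = sumℤ (map (rt lam r ε) (oneTo n))

{-# OPTIONS --safe #-}
module Submission where

-- X_λ · 1 is computed one box at a time, in the order of the factors of X_λ.  The invariant is
-- that the current vector x lies in ℒ_μ for the part μ of λ built so far, and that x η = 0
-- unless η has pluses at the positions still owned by the untouched rows and minuses beyond
-- k + μ₁.  Adding the box (i₀, j + 1) with entry R moves the plus of row i₀ from p to p + 1, so
-- r_μ and r_ν differ only at p and p + 1.  Since r_{i₀ j} > R and r_{i₀-1, j+1} > R, x gains at
-- least R at a minus in position p and R + 1 at a plus in position p + 1 (or vanishes, at the
-- border of λ); this pays for the factor v⁻¹ in T_p and for v^R/[R], which has order 2R - 1.

open import Defs
open import Data.Nat using (ℕ; _≤_; _∸_)
open import Data.Bool using (Bool)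
open import Data.Vec using (Vec)

open import Data.Bool using (true; false; if_then_else_; _∧_; not)
open import Data.Bool.Properties using (∧-zeroʳ)
open import Data.Empty using (⊥-elim)
open import Function using (_∘_)
open import Data.Integer as ℤ using (ℤ; +_; 0ℤ; +≤+; -≤+)
import Data.Integer.Properties as ℤP
open import Data.List using ([]; _∷_; map; applyUpTo; foldl)
import Data.List.Properties as ListP
open import Data.List.Membership.Propositional using (_∈_)
open import Data.List.Membership.Propositional.Properties using (∈-map⁺; ∈-map⁻; ∈-upTo⁺; ∈-upTo⁻)
open import Data.List.Relation.Unary.All as All using (All; []; _∷_)
open import Data.List.Relation.Unary.Any using (here; there)
open import Data.List.Relation.Unary.AllPairs using (_∷_)
open import Data.List.Relation.Unary.Unique.Propositional using (Unique)
import Data.List.Relation.Unary.Unique.Propositional.Properties as Unique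
open import Data.Maybe using (Maybe; just; nothing; fromMaybe)
import Data.Maybe.Relation.Unary.All as Maybe
open import Data.Nat as ℕ using (zero; suc; _+_; _<_; z≤n; s≤s; _≡ᵇ_; _<ᵇ_; _≤ᵇ_; _≟_; _<?_; _≤?_)
import Data.Nat.Properties as ℕP
open import Data.Product using (Σ; _×_; _,_; proj₁; proj₂)
open import Data.Rational as ℚ using (ℚ; 0ℚ; 1ℚ)
import Data.Rational.Properties as ℚP
open import Data.Sum using (_⊎_; inj₁; inj₂)
open import Data.Fin using (toℕ)
open import Data.Vec using ([]; _∷_; tabulate)
open import Relation.Binary.Definitions using (tri<; tri≈; tri>)
open import Relation.Binary.PropositionalEquality
open import Relation.Nullary using (¬_; yes; no)
open import Relation.Nullary.Decidable using (dec-true; dec-false)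

open import Algebra.Properties.CommutativeSemigroup ℤP.+-commutativeSemigroup
  using (interchange; x∙yz≈y∙xz)

-- Polynomials: coefficients and orders of vanishing at v = 0

coeff : Poly → ℕ → ℚ
coeff []      _       = 0ℚ
coeff (a ∷ p) zero    = a
coeff (a ∷ p) (suc i) = coeff p i

VanishesBelow : ℕ → Poly → Set
VanishesBelow m p = ∀ i → i < m → coeff p i ≡ 0ℚ

IsZeroPoly : Poly → Set
IsZeroPoly p = ∀ i → coeff p i ≡ 0ℚ

HasOrder : ℕ → Poly → Set
HasOrder b p = VanishesBelow b p × coeff p b ≢ 0ℚ

coeff-addP : ∀ p q i → coeff (addP p q) i ≡ coeff p i ℚ.+ coeff q i
coeff-addP []      q       i       = sym (ℚP.+-identityˡ _)
coeff-addP (a ∷ p) []      i       = sym (ℚP.+-identityʳ _)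
coeff-addP (a ∷ p) (b ∷ q) zero    = refl
coeff-addP (a ∷ p) (b ∷ q) (suc i) = coeff-addP p q i

coeff-scaleP : ∀ c p i → coeff (scaleP c p) i ≡ c ℚ.* coeff p i
coeff-scaleP c []      i       = sym (ℚP.*-zeroʳ c)
coeff-scaleP c (a ∷ p) zero    = refl
coeff-scaleP c (a ∷ p) (suc i) = coeff-scaleP c p i

coeff-negP : ∀ p i → coeff (negP p) i ≡ ℚ.- coeff p i
coeff-negP []      i       = refl
coeff-negP (a ∷ p) zero    = refl
coeff-negP (a ∷ p) (suc i) = coeff-negP p i

coeff-mulP-zero : ∀ a p q → coeff (mulP (a ∷ p) q) zero ≡ a ℚ.* coeff q zero
coeff-mulP-zero a p q = begin
  coeff (mulP (a ∷ p) q) zero                 ≡⟨ coeff-addP (scaleP a q) (0ℚ ∷ mulP p q) zero ⟩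
  coeff (scaleP a q) zero ℚ.+ 0ℚ              ≡⟨ ℚP.+-identityʳ _ ⟩
  coeff (scaleP a q) zero                     ≡⟨ coeff-scaleP a q zero ⟩
  a ℚ.* coeff q zero                          ∎
  where open ≡-Reasoning

coeff-mulP-suc : ∀ a p q i →
  coeff (mulP (a ∷ p) q) (suc i) ≡ a ℚ.* coeff q (suc i) ℚ.+ coeff (mulP p q) i
coeff-mulP-suc a p q i =
  trans (coeff-addP (scaleP a q) (0ℚ ∷ mulP p q) (suc i))
        (cong (ℚ._+ coeff (mulP p q) i) (coeff-scaleP a q (suc i)))

mulP-vanishesBelow : ∀ a b p q → VanishesBelow a p → VanishesBelow b q →
                     VanishesBelow (a + b) (mulP p q)
mulP-vanishesBelow a b [] q _ _ i _ = refl
mulP-vanishesBelow zero b (c ∷ p) q _ zq zero i<b = begin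
  coeff (mulP (c ∷ p) q) zero  ≡⟨ coeff-mulP-zero c p q ⟩
  c ℚ.* coeff q zero           ≡⟨ cong (c ℚ.*_) (zq zero i<b) ⟩
  c ℚ.* 0ℚ                     ≡⟨ ℚP.*-zeroʳ c ⟩
  0ℚ                           ∎
  where open ≡-Reasoning
mulP-vanishesBelow zero b (c ∷ p) q zp zq (suc i) i<b = begin
  coeff (mulP (c ∷ p) q) (suc i)                    ≡⟨ coeff-mulP-suc c p q i ⟩
  c ℚ.* coeff q (suc i) ℚ.+ coeff (mulP p q) i      ≡⟨ cong₂ ℚ._+_ (cong (c ℚ.*_) (zq (suc i) i<b))
                                                        (mulP-vanishesBelow zero b p q (λ _ ()) zq i
                                                           (ℕP.<-pred (ℕP.m<n⇒m<1+n i<b))) ⟩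
  c ℚ.* 0ℚ ℚ.+ 0ℚ                                  ≡⟨ trans (ℚP.+-identityʳ _) (ℚP.*-zeroʳ c) ⟩
  0ℚ                                                ∎
  where open ≡-Reasoning
mulP-vanishesBelow (suc a) b (c ∷ p) q zp zq zero _ = begin
  coeff (mulP (c ∷ p) q) zero  ≡⟨ coeff-mulP-zero c p q ⟩
  c ℚ.* coeff q zero           ≡⟨ cong (ℚ._* coeff q zero) (zp zero (s≤s z≤n)) ⟩
  0ℚ ℚ.* coeff q zero          ≡⟨ ℚP.*-zeroˡ (coeff q zero) ⟩
  0ℚ                           ∎
  where open ≡-Reasoning
mulP-vanishesBelow (suc a) b (c ∷ p) q zp zq (suc i) (s≤s i<a+b) = begin
  coeff (mulP (c ∷ p) q) (suc i)                    ≡⟨ coeff-mulP-suc c p q i ⟩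
  c ℚ.* coeff q (suc i) ℚ.+ coeff (mulP p q) i      ≡⟨ cong₂ ℚ._+_ (cong (ℚ._* coeff q (suc i)) (zp zero (s≤s z≤n)))
                                                        (mulP-vanishesBelow a b p q (λ i i<a → zp (suc i) (s≤s i<a)) zq i i<a+b) ⟩
  0ℚ ℚ.* coeff q (suc i) ℚ.+ 0ℚ                    ≡⟨ trans (ℚP.+-identityʳ _) (ℚP.*-zeroˡ (coeff q (suc i))) ⟩
  0ℚ                                                ∎
  where open ≡-Reasoning

coeff-mulP-+ : ∀ a b p q → VanishesBelow a p → VanishesBelow b q →
               coeff (mulP p q) (a + b) ≡ coeff p a ℚ.* coeff q b
coeff-mulP-+ a b [] q _ _ = sym (ℚP.*-zeroˡ (coeff q b))
coeff-mulP-+ zero zero (c ∷ p) q _ _ = coeff-mulP-zero c p q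
coeff-mulP-+ zero (suc b) (c ∷ p) q _ zq = begin
  coeff (mulP (c ∷ p) q) (suc b)                    ≡⟨ coeff-mulP-suc c p q b ⟩
  c ℚ.* coeff q (suc b) ℚ.+ coeff (mulP p q) b      ≡⟨ cong (c ℚ.* coeff q (suc b) ℚ.+_)
                                                        (mulP-vanishesBelow zero (suc b) p q (λ _ ()) zq b (ℕP.n<1+n b)) ⟩
  c ℚ.* coeff q (suc b) ℚ.+ 0ℚ                     ≡⟨ ℚP.+-identityʳ _ ⟩
  c ℚ.* coeff q (suc b)                             ∎
  where open ≡-Reasoning
coeff-mulP-+ (suc a) b (c ∷ p) q zp zq = begin
  coeff (mulP (c ∷ p) q) (suc (a + b))              ≡⟨ coeff-mulP-suc c p q (a + b) ⟩
  c ℚ.* coeff q (suc (a + b)) ℚ.+ coeff (mulP p q) (a + b)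
    ≡⟨ cong₂ ℚ._+_ (cong (ℚ._* coeff q (suc (a + b))) (zp zero (s≤s z≤n)))
                   (coeff-mulP-+ a b p q (λ i i<a → zp (suc i) (s≤s i<a)) zq) ⟩
  0ℚ ℚ.* coeff q (suc (a + b)) ℚ.+ coeff p a ℚ.* coeff q b
    ≡⟨ cong (ℚ._+ coeff p a ℚ.* coeff q b) (ℚP.*-zeroˡ (coeff q (suc (a + b)))) ⟩
  0ℚ ℚ.+ coeff p a ℚ.* coeff q b                   ≡⟨ ℚP.+-identityˡ _ ⟩
  coeff p a ℚ.* coeff q b                           ∎
  where open ≡-Reasoning

*-≢0 : ∀ x y → x ≢ 0ℚ → y ≢ 0ℚ → x ℚ.* y ≢ 0ℚ
*-≢0 x y x≢0 y≢0 xy≡0 = y≢0 (begin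
  y                 ≡⟨ sym (ℚP.*-identityˡ y) ⟩
  1ℚ ℚ.* y          ≡⟨ cong (ℚ._* y) (sym (ℚP.*-inverseˡ x)) ⟩
  x⁻¹ ℚ.* x ℚ.* y   ≡⟨ ℚP.*-assoc x⁻¹ x y ⟩
  x⁻¹ ℚ.* (x ℚ.* y) ≡⟨ cong (x⁻¹ ℚ.*_) xy≡0 ⟩
  x⁻¹ ℚ.* 0ℚ        ≡⟨ ℚP.*-zeroʳ x⁻¹ ⟩
  0ℚ                ∎)
  where
  open ≡-Reasoning
  instance
    x-nonZero : ℚ.NonZero x
    x-nonZero = ℚ.≢-nonZero x≢0
  x⁻¹ : ℚ
  x⁻¹ = ℚ.1/ x

mulP-hasOrder : ∀ a b p q → HasOrder a p → HasOrder b q → HasOrder (a + b) (mulP p q)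
mulP-hasOrder a b p q (zp , p≢0) (zq , q≢0) =
  mulP-vanishesBelow a b p q zp zq ,
  λ pq≡0 → *-≢0 _ _ p≢0 q≢0 (trans (sym (coeff-mulP-+ a b p q zp zq)) pq≡0)

isZeroPoly-mulPˡ : ∀ p q → IsZeroPoly p → IsZeroPoly (mulP p q)
isZeroPoly-mulPˡ p q zp i =
  mulP-vanishesBelow (suc i) 0 p q (λ j _ → zp j) (λ _ ()) i
    (subst (i <_) (sym (ℕP.+-identityʳ (suc i))) (ℕP.n<1+n i))

isZeroPoly-mulPʳ : ∀ p q → IsZeroPoly q → IsZeroPoly (mulP p q)
isZeroPoly-mulPʳ p q zq i = mulP-vanishesBelow 0 (suc i) p q (λ _ ()) (λ j _ → zq j) i (ℕP.n<1+n i)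

isZeroPoly-addP : ∀ p q → IsZeroPoly p → IsZeroPoly q → IsZeroPoly (addP p q)
isZeroPoly-addP p q zp zq i = trans (coeff-addP p q i) (cong₂ ℚ._+_ (zp i) (zq i))

isZeroPoly-negP : ∀ p → IsZeroPoly p → IsZeroPoly (negP p)
isZeroPoly-negP p zp i = trans (coeff-negP p i) (cong ℚ.-_ (zp i))

isZeroPoly⇒vanishesBelow : ∀ m p → IsZeroPoly p → VanishesBelow m p
isZeroPoly⇒vanishesBelow m p zp i _ = zp i

vanishesBelow-addP : ∀ m p q → VanishesBelow m p → VanishesBelow m q → VanishesBelow m (addP p q)
vanishesBelow-addP m p q zp zq i i<m = trans (coeff-addP p q i) (cong₂ ℚ._+_ (zp i i<m) (zq i i<m))

vanishesBelow-negP : ∀ m p → VanishesBelow m p → VanishesBelow m (negP p)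
vanishesBelow-negP m p zp i i<m = trans (coeff-negP p i) (cong ℚ.-_ (zp i i<m))

vanishesBelow-≤ : ∀ {m m′} p → m′ ≤ m → VanishesBelow m p → VanishesBelow m′ p
vanishesBelow-≤ p m′≤m zp i i<m′ = zp i (ℕP.<-≤-trans i<m′ m′≤m)

hasOrder-unique : ∀ a b p → HasOrder a p → HasOrder b p → a ≡ b
hasOrder-unique a b p (za , a≢0) (zb , b≢0) with ℕP.<-cmp a b
... | tri< a<b _ _ = ⊥-elim (a≢0 (zb a a<b))
... | tri≈ _ a≡b _ = a≡b
... | tri> _ _ b<a = ⊥-elim (b≢0 (za b b<a))

ordP≡nothing⇒isZeroPoly : ∀ p → ordP p ≡ nothing → IsZeroPoly p
ordP≡nothing⇒isZeroPoly []      _ _ = refl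
ordP≡nothing⇒isZeroPoly (a ∷ p) e i with a ℚ.≟ 0ℚ
ordP≡nothing⇒isZeroPoly (a ∷ p) () i | no _
... | yes a≡0 with ordP p in ordP-p≡ | e | i
...   | nothing | _ | zero  = a≡0
...   | nothing | _ | suc i = ordP≡nothing⇒isZeroPoly p ordP-p≡ i

ordP≡just⇒hasOrder : ∀ p b → ordP p ≡ just b → HasOrder b p
ordP≡just⇒hasOrder (a ∷ p) b e with a ℚ.≟ 0ℚ
... | no a≢0 with refl ← e = (λ _ ()) , a≢0
... | yes a≡0 with ordP p in ordP-p≡ | e
...   | just b′ | refl = vanishes , proj₂ (ordP≡just⇒hasOrder p b′ ordP-p≡)
  where
  vanishes : VanishesBelow (suc b′) (a ∷ p)
  vanishes zero    _           = a≡0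
  vanishes (suc i) (s≤s i<b′) = proj₁ (ordP≡just⇒hasOrder p b′ ordP-p≡) i i<b′

isZeroPoly⇒ordP≡nothing : ∀ p → IsZeroPoly p → ordP p ≡ nothing
isZeroPoly⇒ordP≡nothing p zp with ordP p in e
... | nothing = refl
... | just b  = ⊥-elim (proj₂ (ordP≡just⇒hasOrder p b e) (zp b))

isZeroPoly-or-hasOrder : ∀ p → IsZeroPoly p ⊎ Σ ℕ (λ b → HasOrder b p)
isZeroPoly-or-hasOrder p with ordP p in e
... | nothing = inj₁ (ordP≡nothing⇒isZeroPoly p e)
... | just b  = inj₂ (b , ordP≡just⇒hasOrder p b e)

-- Orders of elements of ℚ(v)

IsZero : Qv → Set
IsZero f = IsZeroPoly (num f)

-- A proof-relevant form of InO: a lower bound for the order of vanishing of the numerator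
-- suffices, which makes the notion closed under sums.
data Ord≥ (m : ℤ) (f : Qv) : Set where
  vanishing : IsZero f → Ord≥ m f
  bounded   : ∀ {α β} → VanishesBelow α (num f) → HasOrder β (den f) → m ℤ.+ + β ℤ.≤ + α → Ord≥ m f

isZero-+ : ∀ f g → IsZero f → IsZero g → IsZero (f +F g)
isZero-+ (a /ₚ b) (c /ₚ d) za zc =
  isZeroPoly-addP (mulP a d) (mulP c b) (isZeroPoly-mulPˡ a d za) (isZeroPoly-mulPˡ c b zc)

isZero-* : ∀ f g → IsZero g → IsZero (f *F g)
isZero-* (a /ₚ b) (c /ₚ d) zc = isZeroPoly-mulPʳ a c zc

Ord≥-mono : ∀ {m m′} f → m′ ℤ.≤ m → Ord≥ m f → Ord≥ m′ f
Ord≥-mono f _    (vanishing z)         = vanishing z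
Ord≥-mono f m′≤m (bounded {β = β} za hb h) = bounded za hb (ℤP.≤-trans (ℤP.+-monoˡ-≤ (+ β) m′≤m) h)

Ord≥-neg : ∀ {m} f → Ord≥ m f → Ord≥ m (-F f)
Ord≥-neg (a /ₚ b) (vanishing z)  = vanishing (isZeroPoly-negP a z)
Ord≥-neg (a /ₚ b) (bounded za hb h) = bounded (vanishesBelow-negP _ a za) hb h

Ord≥-* : ∀ {m m′} f g → Ord≥ m f → Ord≥ m′ g → Ord≥ (m ℤ.+ m′) (f *F g)
Ord≥-* (a /ₚ b) (c /ₚ d) (vanishing za) _ = vanishing (isZeroPoly-mulPˡ a c za)
Ord≥-* (a /ₚ b) (c /ₚ d) (bounded _ _ _) (vanishing zc) = vanishing (isZeroPoly-mulPʳ a c zc)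
Ord≥-* {m} {m′} (a /ₚ b) (c /ₚ d) (bounded {α} {β} za hb h) (bounded {γ} {δ} zc hd h′) =
  bounded (mulP-vanishesBelow α γ a c za zc) (mulP-hasOrder β δ b d hb hd)
    (ℤP.≤-trans (ℤP.≤-reflexive (interchange m m′ (+ β) (+ δ))) (ℤP.+-mono-≤ h h′))

private
  bound-+ˡ : ∀ m β δ α → m ℤ.+ + β ℤ.≤ + α → m ℤ.+ (+ β ℤ.+ + δ) ℤ.≤ + α ℤ.+ + δ
  bound-+ˡ m β δ α h = ℤP.≤-trans (ℤP.≤-reflexive (sym (ℤP.+-assoc m (+ β) (+ δ)))) (ℤP.+-monoˡ-≤ (+ δ) h)

  bound-+ʳ : ∀ m β δ γ → m ℤ.+ + δ ℤ.≤ + γ → m ℤ.+ (+ β ℤ.+ + δ) ℤ.≤ + γ ℤ.+ + β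
  bound-+ʳ m β δ γ h = ℤP.≤-trans (ℤP.≤-reflexive (cong (λ x → m ℤ.+ x) (ℤP.+-comm (+ β) (+ δ))))
                                  (bound-+ˡ m δ β γ h)

Ord≥-+ : ∀ {m} f g → Ord≥ m f → Ord≥ m g → Ord≥ m (f +F g)
Ord≥-+ f g (vanishing zf) (vanishing zg) = vanishing (isZero-+ f g zf zg)
Ord≥-+ {m} (a /ₚ b) (c /ₚ d) (vanishing za) (bounded {γ} {δ} zc hd h) with isZeroPoly-or-hasOrder b
... | inj₁ zb = vanishing (isZeroPoly-addP (mulP a d) (mulP c b) (isZeroPoly-mulPˡ a d za) (isZeroPoly-mulPʳ c b zb))
... | inj₂ (β , hb) =
  bounded (vanishesBelow-addP _ (mulP a d) (mulP c b)
            (isZeroPoly⇒vanishesBelow _ (mulP a d) (isZeroPoly-mulPˡ a d za))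
            (mulP-vanishesBelow γ β c b zc (proj₁ hb)))
          (mulP-hasOrder β δ b d hb hd) (bound-+ʳ m β δ γ h)
Ord≥-+ {m} (a /ₚ b) (c /ₚ d) (bounded {α} {β} za hb h) (vanishing zc) with isZeroPoly-or-hasOrder d
... | inj₁ zd = vanishing (isZeroPoly-addP (mulP a d) (mulP c b) (isZeroPoly-mulPʳ a d zd) (isZeroPoly-mulPˡ c b zc))
... | inj₂ (δ , hd) =
  bounded (vanishesBelow-addP _ (mulP a d) (mulP c b)
            (mulP-vanishesBelow α δ a d za (proj₁ hd))
            (isZeroPoly⇒vanishesBelow _ (mulP c b) (isZeroPoly-mulPˡ c b zc)))
          (mulP-hasOrder β δ b d hb hd) (bound-+ˡ m β δ α h)
Ord≥-+ {m} (a /ₚ b) (c /ₚ d) (bounded {α} {β} za hb h) (bounded {γ} {δ} zc hd h′) =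
  bounded (vanishesBelow-addP _ (mulP a d) (mulP c b)
            (vanishesBelow-≤ (mulP a d) (ℕP.m⊓n≤m _ _) (mulP-vanishesBelow α δ a d za (proj₁ hd)))
            (vanishesBelow-≤ (mulP c b) (ℕP.m⊓n≤n _ _) (mulP-vanishesBelow γ β c b zc (proj₁ hb))))
          (mulP-hasOrder β δ b d hb hd)
          (ℤP.⊓-glb (bound-+ˡ m β δ α h) (bound-+ʳ m β δ γ h′))

Ord≥⇒InO : ∀ m f → Ord≥ m f → InO m f
Ord≥⇒InO m f (vanishing z) = inj₁ (isZeroPoly⇒ordP≡nothing (num f) z)
Ord≥⇒InO m f (bounded {α} {β} za hb h) with ordP (num f) in e₁ | ordP (den f) in e₂
... | nothing | _       = inj₁ refl
... | just a  | nothing = ⊥-elim (proj₂ hb (ordP≡nothing⇒isZeroPoly (den f) e₂ β))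
... | just a  | just b  = inj₂ (a , b , refl , refl ,
      subst (λ b → m ℤ.+ + b ℤ.≤ + a) (hasOrder-unique β b (den f) hb (ordP≡just⇒hasOrder (den f) b e₂))
            (ℤP.≤-trans h (+≤+ α≤a)))
  where
  α≤a : α ≤ a
  α≤a = ℕP.≮⇒≥ (λ a<α → proj₂ (ordP≡just⇒hasOrder (num f) a e₁) (za a a<α))

monoP-hasOrder : ∀ r → HasOrder r (monoP r)
monoP-hasOrder zero    = (λ _ ()) , λ ()
monoP-hasOrder (suc r) = vanishes , proj₂ (monoP-hasOrder r)
  where
  vanishes : VanishesBelow (suc r) (monoP (suc r))
  vanishes zero    _         = refl
  vanishes (suc i) (s≤s i<r) = proj₁ (monoP-hasOrder r) i i<r

one-hasOrder : HasOrder 0 (1ℚ ∷ [])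
one-hasOrder = (λ _ ()) , λ ()

1·v-hasOrder : HasOrder 1 (mulP (1ℚ ∷ []) (monoP 1))
1·v-hasOrder = mulP-hasOrder 0 1 (1ℚ ∷ []) (monoP 1) one-hasOrder (monoP-hasOrder 1)

Ord≥-1F : Ord≥ 0ℤ 1F
Ord≥-1F = bounded {α = 0} (λ _ ()) one-hasOrder ℤP.≤-refl

Ord≥-v-v⁻¹ : Ord≥ (ℤ.- + 1) (vF -F v⁻¹F)
Ord≥-v-v⁻¹ = bounded {α = 0} (λ _ ()) 1·v-hasOrder ℤP.≤-refl

Ord≥-neg-v⁻¹ : Ord≥ (ℤ.- + 1) (-F v⁻¹F)
Ord≥-neg-v⁻¹ = bounded {α = 0} (λ _ ()) (monoP-hasOrder 1) ℤP.≤-refl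

boxOrder : ℕ → ℤ
boxOrder r = + (r + r) ℤ.- + 1

-- v^r / [r] = v^r (v - v⁻¹) / (v^r - v⁻ʳ) is represented as
-- v^r · (1 · v^r) · (v² - 1)  over  1 · ((v^{2r} - 1) · (1 · v)).
Ord≥-v^r/[r] : ∀ r → 1 ≤ r → Ord≥ (boxOrder r) (vpow r ÷F qint r)
Ord≥-v^r/[r] (suc r) _ =
  bounded (mulP-vanishesBelow R R (monoP R) (mulP 1·v^r v²-1) (proj₁ (monoP-hasOrder R))
             (subst (λ m → VanishesBelow m (mulP 1·v^r v²-1)) (ℕP.+-identityʳ R)
               (mulP-vanishesBelow R 0 1·v^r v²-1 (proj₁ 1·v^r-hasOrder) (λ _ ()))))
          (mulP-hasOrder 0 1 (1ℚ ∷ []) (mulP v^2r-1 1·v) one-hasOrder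
             (mulP-hasOrder 0 1 v^2r-1 1·v v^2r-1-hasOrder 1·v-hasOrder))
          (+≤+ (ℕP.≤-reflexive (ℕP.+-comm (r + suc r) 1)))
  where
  R : ℕ
  R = suc r
  1·v 1·v^r v²-1 v^2r-1 : Poly
  1·v    = mulP (1ℚ ∷ []) (monoP 1)
  1·v^r  = mulP (1ℚ ∷ []) (monoP R)
  v²-1   = num (vF -F v⁻¹F)
  v^2r-1 = addP (mulP (monoP R) (monoP R)) (mulP (negP (1ℚ ∷ [])) (1ℚ ∷ []))
  1·v^r-hasOrder : HasOrder R 1·v^r
  1·v^r-hasOrder = mulP-hasOrder 0 R (1ℚ ∷ []) (monoP R) one-hasOrder (monoP-hasOrder R)
  v^2r-1-hasOrder : HasOrder 0 v^2r-1
  v^2r-1-hasOrder = (λ _ ()) , λ c₀≡0 → -1≢0 (trans (sym constant-term) c₀≡0)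
    where
    -1≢0 : ℚ.- 1ℚ ≢ 0ℚ
    -1≢0 ()
    constant-term : coeff v^2r-1 0 ≡ ℚ.- 1ℚ
    constant-term = begin
      coeff v^2r-1 0
        ≡⟨ coeff-addP (mulP (monoP R) (monoP R)) (mulP (negP (1ℚ ∷ [])) (1ℚ ∷ [])) 0 ⟩
      coeff (mulP (monoP R) (monoP R)) 0 ℚ.+ ℚ.- 1ℚ
        ≡⟨ cong (ℚ._+ ℚ.- 1ℚ) (mulP-vanishesBelow R R (monoP R) (monoP R)
             (proj₁ (monoP-hasOrder R)) (proj₁ (monoP-hasOrder R)) 0 (s≤s z≤n)) ⟩
      ℚ.- 1ℚ
        ∎
      where open ≡-Reasoning

Ord≥-shift : ∀ {m a b} f → a ℤ.≤ b → Ord≥ (m ℤ.+ b) f → Ord≥ (m ℤ.+ a) f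
Ord≥-shift {m} f a≤b = Ord≥-mono f (ℤP.+-monoʳ-≤ m a≤b)

Ord≥-scale : ∀ {e m a b} c f → Ord≥ e c → Ord≥ (m ℤ.+ b) f → a ℤ.≤ e ℤ.+ b → Ord≥ (m ℤ.+ a) (c *F f)
Ord≥-scale {e} {m} {a} {b} c f c-ord f-ord a≤e+b =
  Ord≥-mono (c *F f) (ℤP.≤-trans (ℤP.+-monoʳ-≤ m a≤e+b) (ℤP.≤-reflexive (x∙yz≈y∙xz m e b)))
            (Ord≥-* c f c-ord f-ord)

≡ᵇ-true : ∀ {m n} → m ≡ n → (m ≡ᵇ n) ≡ true
≡ᵇ-true {m} {n} = dec-true (m ≟ n)

≡ᵇ-false : ∀ {m n} → m ≢ n → (m ≡ᵇ n) ≡ false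
≡ᵇ-false {m} {n} = dec-false (m ≟ n)

<ᵇ-true : ∀ {m n} → m < n → (m <ᵇ n) ≡ true
<ᵇ-true {m} {n} = dec-true (m <? n)

<ᵇ-false : ∀ {m n} → ¬ m < n → (m <ᵇ n) ≡ false
<ᵇ-false {m} {n} = dec-false (m <? n)

≤ᵇ-true : ∀ {m n} → m ≤ n → (m ≤ᵇ n) ≡ true
≤ᵇ-true {m} {n} = dec-true (m ≤? n)

≤ᵇ-false : ∀ {m n} → ¬ m ≤ n → (m ≤ᵇ n) ≡ false
≤ᵇ-false {m} {n} = dec-false (m ≤? n)

_∖_ : (ℕ → ℤ) → ℕ → ℕ → ℤ
(g ∖ q) t = if t ≡ᵇ q then 0ℤ else g t

∖-≢ : ∀ g {q t} → t ≢ q → (g ∖ q) t ≡ g t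
∖-≢ g t≢q rewrite ≡ᵇ-false t≢q = refl

∖-cong : ∀ g g′ q t → (t ≢ q → g t ≡ g′ t) → (g ∖ q) t ≡ (g′ ∖ q) t
∖-cong g g′ q t g≡g′ with t ≟ q
... | yes t≡q rewrite ≡ᵇ-true t≡q = refl
... | no  t≢q rewrite ≡ᵇ-false t≢q = g≡g′ t≢q

sumℤ-∖-pair-cong : ∀ g g′ p l → (∀ t → t ≢ p → t ≢ suc p → g t ≡ g′ t) →
                   sumℤ (map ((g ∖ suc p) ∖ p) l) ≡ sumℤ (map ((g′ ∖ suc p) ∖ p) l)
sumℤ-∖-pair-cong g g′ p l g≡g′ = cong sumℤ (ListP.map-cong (λ t →
  ∖-cong (g ∖ suc p) (g′ ∖ suc p) p t (λ t≢p → ∖-cong g g′ (suc p) t (g≡g′ t t≢p))) l)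

sumℤ-∖-∉ : ∀ g {q} l → All (q ≢_) l → sumℤ (map (g ∖ q) l) ≡ sumℤ (map g l)
sumℤ-∖-∉ g []      []             = refl
sumℤ-∖-∉ g (t ∷ l) (q≢t ∷ q∉l) = cong₂ ℤ._+_ (∖-≢ g (λ t≡q → q≢t (sym t≡q))) (sumℤ-∖-∉ g l q∉l)

sumℤ-∖-∈ : ∀ g {q} l → Unique l → q ∈ l → sumℤ (map g l) ≡ sumℤ (map (g ∖ q) l) ℤ.+ g q
sumℤ-∖-∈ g (q ∷ l) (q∉l ∷ _) (here refl) = begin
  g q ℤ.+ sumℤ (map g l)                          ≡⟨ ℤP.+-comm (g q) _ ⟩
  sumℤ (map g l) ℤ.+ g q                          ≡⟨ cong (ℤ._+ g q) (sym (ℤP.+-identityˡ (sumℤ (map g l)))) ⟩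
  (0ℤ ℤ.+ sumℤ (map g l)) ℤ.+ g q                 ≡⟨ cong₂ (λ a b → (a ℤ.+ b) ℤ.+ g q)
                                                       (sym (∖-self q)) (sym (sumℤ-∖-∉ g l q∉l)) ⟩
  ((g ∖ q) q ℤ.+ sumℤ (map (g ∖ q) l)) ℤ.+ g q    ∎
  where
  open ≡-Reasoning
  ∖-self : ∀ q → (g ∖ q) q ≡ 0ℤ
  ∖-self q rewrite ≡ᵇ-true {q} refl = refl
sumℤ-∖-∈ g {q} (t ∷ l) (t∉l ∷ unique) (there q∈l) = begin
  g t ℤ.+ sumℤ (map g l)                            ≡⟨ cong (λ z → g t ℤ.+ z) (sumℤ-∖-∈ g l unique q∈l) ⟩
  g t ℤ.+ (sumℤ (map (g ∖ q) l) ℤ.+ g q)            ≡⟨ sym (ℤP.+-assoc (g t) _ (g q)) ⟩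
  (g t ℤ.+ sumℤ (map (g ∖ q) l)) ℤ.+ g q            ≡⟨ cong (λ z → (z ℤ.+ sumℤ (map (g ∖ q) l)) ℤ.+ g q)
                                                         (sym (∖-≢ g (All.lookup t∉l q∈l))) ⟩
  ((g ∖ q) t ℤ.+ sumℤ (map (g ∖ q) l)) ℤ.+ g q      ∎
  where open ≡-Reasoning

oneTo-unique : ∀ n → Unique (oneTo n)
oneTo-unique n = Unique.map⁺ ℕP.suc-injective (Unique.upTo⁺ n)

∈-oneTo : ∀ {n t} → 1 ≤ t → t ≤ n → t ∈ oneTo n
∈-oneTo {n} {suc t} _ t<n = ∈-map⁺ suc (∈-upTo⁺ t<n)

∈-oneTo⁻ : ∀ {n t} → t ∈ oneTo n → 1 ≤ t × t ≤ n
∈-oneTo⁻ t∈ with t′ , t′∈ , refl ← ∈-map⁻ suc t∈ = s≤s z≤n , ∈-upTo⁻ t′∈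

sumℤ-split-pair : ∀ g n p → 1 ≤ p → suc p ≤ n →
  sumℤ (map g (oneTo n)) ≡ sumℤ (map ((g ∖ suc p) ∖ p) (oneTo n)) ℤ.+ (g p ℤ.+ g (suc p))
sumℤ-split-pair g n p 1≤p sp≤n = begin
  sumℤ (map g (oneTo n))
    ≡⟨ sumℤ-∖-∈ g (oneTo n) (oneTo-unique n) (∈-oneTo (s≤s z≤n) sp≤n) ⟩
  sumℤ (map (g ∖ suc p) (oneTo n)) ℤ.+ g (suc p)
    ≡⟨ cong (ℤ._+ g (suc p)) (sumℤ-∖-∈ (g ∖ suc p) (oneTo n) (oneTo-unique n) (∈-oneTo 1≤p (ℕP.<⇒≤ sp≤n))) ⟩
  (sumℤ (map ((g ∖ suc p) ∖ p) (oneTo n)) ℤ.+ (g ∖ suc p) p) ℤ.+ g (suc p)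
    ≡⟨ cong (λ z → (sumℤ (map ((g ∖ suc p) ∖ p) (oneTo n)) ℤ.+ z) ℤ.+ g (suc p))
            (∖-≢ g (ℕP.<⇒≢ (ℕP.n<1+n p))) ⟩
  (sumℤ (map ((g ∖ suc p) ∖ p) (oneTo n)) ℤ.+ g p) ℤ.+ g (suc p)
    ≡⟨ ℤP.+-assoc (sumℤ (map ((g ∖ suc p) ∖ p) (oneTo n))) (g p) (g (suc p)) ⟩
  sumℤ (map ((g ∖ suc p) ∖ p) (oneTo n)) ℤ.+ (g p ℤ.+ g (suc p)) ∎
  where open ≡-Reasoning

pick-nothing : ∀ (g : ℕ → Maybe ℤ) l → All (λ i → g i ≡ nothing) l → pick (map g l) ≡ 0ℤ
pick-nothing g []      []                = refl
pick-nothing g (i ∷ l) (gi≡nothing ∷ all) rewrite gi≡nothing = pick-nothing g l all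

pick-unique : ∀ (g : ℕ → Maybe ℤ) {i} l → i ∈ l → All (λ j → g j ≡ nothing ⊎ j ≡ i) l →
              pick (map g l) ≡ fromMaybe 0ℤ (g i)
pick-unique g {i} (j ∷ l) _ (inj₂ refl ∷ rest) with g i in gi≡
... | just _  = refl
... | nothing = pick-nothing g l (All.map (λ { (inj₁ e) → e ; (inj₂ refl) → gi≡ }) rest)
pick-unique g (j ∷ l) (here refl) (inj₁ gj≡nothing ∷ rest) rewrite gj≡nothing =
  pick-nothing g l (All.map (λ { (inj₁ e) → e ; (inj₂ refl) → gj≡nothing }) rest)
pick-unique g (j ∷ l) (there i∈l) (inj₁ gj≡nothing ∷ rest) rewrite gj≡nothing = pick-unique g l i∈l rest

pick-≤0 : ∀ (g : ℕ → Maybe ℤ) l → (∀ i → Maybe.All (ℤ._≤ 0ℤ) (g i)) → pick (map g l) ℤ.≤ 0ℤ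
pick-≤0 g []      _ = ℤP.≤-refl
pick-≤0 g (i ∷ l) h with g i | h i
... | nothing | _           = pick-≤0 g l h
... | just _  | Maybe.just z≤0 = z≤0

sumℤ-≤0 : ∀ (f : ℕ → ℤ) l → (∀ t → f t ℤ.≤ 0ℤ) → sumℤ (map f l) ℤ.≤ 0ℤ
sumℤ-≤0 f []      _ = ℤP.≤-refl
sumℤ-≤0 f (t ∷ l) h = ℤP.+-mono-≤ (h t) (sumℤ-≤0 f l h)

foldl-applyUpTo-induction : ∀ {A : Set} (P : ℕ → A → Set) (g : A → ℕ → A) (f : ℕ → ℕ) c {x} → P 0 x →
  (∀ i {y} → i < c → P i y → P (suc i) (g y (f i))) → P c (foldl g x (applyUpTo f c))
foldl-applyUpTo-induction P g f zero    p₀ step = p₀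
foldl-applyUpTo-induction P g f (suc c) p₀ step =
  foldl-applyUpTo-induction (λ i → P (suc i)) g (λ i → f (suc i)) c (step 0 (s≤s z≤n) p₀)
                            (λ i i<c → step (suc i) (s≤s i<c))

foldl-oneTo-induction : ∀ {A : Set} (P : ℕ → A → Set) (g : A → ℕ → A) c {x} → P 0 x →
  (∀ i {y} → i < c → P i y → P (suc i) (g y (suc i))) → P c (foldl g x (oneTo c))
foldl-oneTo-induction P g c {x} p₀ step =
  subst (λ l → P c (foldl g x l)) (sym (ListP.map-upTo suc c)) (foldl-applyUpTo-induction P g suc c p₀ step)

-- Sign vectors and the generators T_q

sgn-swapAt-left : ∀ {n} p (η : Vec Bool n) → 1 ≤ p → suc p ≤ n → sgn (swapAt p η) p ≡ sgn η (suc p)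
sgn-swapAt-left (suc zero)    (x ∷ y ∷ xs) _ _         = refl
sgn-swapAt-left (suc zero)    (x ∷ [])     _ (s≤s ())
sgn-swapAt-left (suc (suc p)) (x ∷ xs)     _ (s≤s p≤) = sgn-swapAt-left (suc p) xs (s≤s z≤n) p≤

sgn-swapAt-right : ∀ {n} p (η : Vec Bool n) → 1 ≤ p → suc p ≤ n → sgn (swapAt p η) (suc p) ≡ sgn η p
sgn-swapAt-right (suc zero)    (x ∷ y ∷ xs) _ _         = refl
sgn-swapAt-right (suc zero)    (x ∷ [])     _ (s≤s ())
sgn-swapAt-right (suc (suc p)) (x ∷ xs)     _ (s≤s p≤) = sgn-swapAt-right (suc p) xs (s≤s z≤n) p≤

sgn-swapAt-other : ∀ {n} p (η : Vec Bool n) t → t ≢ p → t ≢ suc p → sgn (swapAt p η) t ≡ sgn η t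
sgn-swapAt-other zero                  η                  t                   _   _   = refl
sgn-swapAt-other (suc zero)            []                 t                   _   _   = refl
sgn-swapAt-other (suc zero)            (x ∷ [])           t                   _   _   = refl
sgn-swapAt-other (suc zero)            (x ∷ y ∷ xs)       zero                _   _   = refl
sgn-swapAt-other (suc zero)            (x ∷ y ∷ xs)       (suc zero)          t≢p _   = ⊥-elim (t≢p refl)
sgn-swapAt-other (suc zero)            (x ∷ y ∷ xs)       (suc (suc zero))    _   t≢p = ⊥-elim (t≢p refl)
sgn-swapAt-other (suc zero)            (x ∷ y ∷ xs)       (suc (suc (suc t))) _   _   = refl
sgn-swapAt-other (suc (suc p))         []                 t                   _   _   = refl
sgn-swapAt-other (suc (suc p))         (x ∷ xs)           zero                _   _   = refl
sgn-swapAt-other (suc (suc p))         (x ∷ xs)           (suc zero)          _   _   = refl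
sgn-swapAt-other (suc (suc p))         (x ∷ xs)           (suc (suc t)) t≢p t≢sp =
  sgn-swapAt-other (suc p) xs (suc t) (λ e → t≢p (cong suc e)) (λ e → t≢sp (cong suc e))

module _ {n : ℕ} (q : ℕ) (x : M n) (η : Vec Bool n) where

  T-+− : sgn η q ≡ true → sgn η (suc q) ≡ false → T q x η ≡ x (swapAt q η)
  T-+− e₁ e₂ with sgn η q | sgn η (suc q)
  T-+− refl refl | true | false = refl

  T-−+ : sgn η q ≡ false → sgn η (suc q) ≡ true → T q x η ≡ x (swapAt q η) +F ((vF -F v⁻¹F) *F x η)
  T-−+ e₁ e₂ with sgn η q | sgn η (suc q)
  T-−+ refl refl | false | true = refl

  T-++ : sgn η q ≡ true → sgn η (suc q) ≡ true → T q x η ≡ (-F v⁻¹F) *F x η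
  T-++ e₁ e₂ with sgn η q | sgn η (suc q)
  T-++ refl refl | true | true = refl

  T-−− : sgn η q ≡ false → sgn η (suc q) ≡ false → T q x η ≡ (-F v⁻¹F) *F x η
  T-−− e₁ e₂ with sgn η q | sgn η (suc q)
  T-−− refl refl | false | false = refl

Violates : ∀ {n} → ℕ → ℕ → Vec Bool n → Set
Violates L H η = (Σ ℕ λ t → 1 ≤ t × t ≤ L × sgn η t ≡ false) ⊎ (Σ ℕ λ t → H < t × sgn η t ≡ true)

violates-weaken : ∀ {n} (η : Vec Bool n) {L H L′ H′} → L′ ≤ L → H ≤ H′ → Violates L′ H′ η → Violates L H η
violates-weaken η L′≤L H≤H′ (inj₁ (t , 1≤t , t≤L′ , η-t)) = inj₁ (t , 1≤t , ℕP.≤-trans t≤L′ L′≤L , η-t)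
violates-weaken η L′≤L H≤H′ (inj₂ (t , H′<t , η-t))      = inj₂ (t , ℕP.≤-<-trans H≤H′ H′<t , η-t)

violates-swapAt : ∀ {n} p (η : Vec Bool n) {L H L′ H′} → L′ ≤ L → H ≤ H′ → L′ < p → suc p ≤ H′ →
                  Violates L′ H′ η → Violates L H (swapAt p η)
violates-swapAt p η L′≤L H≤H′ L′<p sp≤H′ (inj₁ (t , 1≤t , t≤L′ , η-t)) =
  inj₁ (t , 1≤t , ℕP.≤-trans t≤L′ L′≤L ,
        trans (sgn-swapAt-other p η t (ℕP.<⇒≢ t<p) (ℕP.<⇒≢ (ℕP.m<n⇒m<1+n t<p))) η-t)
  where
  t<p : t < p
  t<p = ℕP.≤-<-trans t≤L′ L′<p
violates-swapAt p η L′≤L H≤H′ L′<p sp≤H′ (inj₂ (t , H′<t , η-t)) =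
  inj₂ (t , ℕP.≤-<-trans H≤H′ H′<t ,
        trans (sgn-swapAt-other p η t (ℕP.>⇒≢ (ℕP.<-trans (ℕP.n<1+n p) sp<t)) (ℕP.>⇒≢ sp<t)) η-t)
  where
  sp<t : suc p < t
  sp<t = ℕP.≤-<-trans sp≤H′ H′<t

sgn-tabulate-< : ∀ {n} (g : ℕ → Bool) t → t < n → sgn (tabulate {n = n} (λ i → g (toℕ i))) (suc t) ≡ g t
sgn-tabulate-< {suc n} g zero    _         = refl
sgn-tabulate-< {suc n} g (suc t) (s≤s t<n) = sgn-tabulate-< (λ i → g (suc i)) t t<n

sgn-tabulate-≥ : ∀ {n} (g : ℕ → Bool) t → n ≤ t → sgn (tabulate {n = n} (λ i → g (toℕ i))) (suc t) ≡ false
sgn-tabulate-≥ {zero}  g t       _         = refl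
sgn-tabulate-≥ {suc n} g (suc t) (s≤s n≤t) = sgn-tabulate-≥ (λ i → g (suc i)) t n≤t

eqVec-sound : ∀ {n} (a b : Vec Bool n) → eqVec a b ≡ true → a ≡ b
eqVec-sound []          []          _ = refl
eqVec-sound (true ∷ a)  (true ∷ b)  e = cong (true ∷_) (eqVec-sound a b e)
eqVec-sound (false ∷ a) (false ∷ b) e = cong (false ∷_) (eqVec-sound a b e)

module _ {n k : ℕ} (k≤n : k ≤ n) where

  sgn-oneVec-≤ : ∀ {t} → 1 ≤ t → t ≤ k → sgn (oneVec n k) t ≡ true
  sgn-oneVec-≤ {suc t} _ t<k = trans (sgn-tabulate-< (_<ᵇ k) t (ℕP.<-≤-trans t<k k≤n)) (<ᵇ-true t<k)

  sgn-oneVec-> : ∀ {t} → k < t → sgn (oneVec n k) t ≡ false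
  sgn-oneVec-> {suc t} (s≤s k≤t) with t <? n
  ... | yes t<n = trans (sgn-tabulate-< (_<ᵇ k) t t<n) (<ᵇ-false (ℕP.≤⇒≯ k≤t))
  ... | no  t≮n = sgn-tabulate-≥ (_<ᵇ k) t (ℕP.≮⇒≥ t≮n)

  oneVec-no-violation : ¬ Violates k (k + 0) (oneVec n k)
  oneVec-no-violation (inj₁ (t , 1≤t , t≤k , ε-t)) with () ← trans (sym (sgn-oneVec-≤ 1≤t t≤k)) ε-t
  oneVec-no-violation (inj₂ (t , k<t , ε-t)) with () ← trans (sym ε-t) (sgn-oneVec-> (subst (_< t) (ℕP.+-identityʳ k) k<t))

-- When the box with entry R is added, the weight at the two positions p, p + 1 it touches becomes
-- νOrder R (ε_p) (ε_{p+1}); before, it was at least μFloor R (ε_p) (ε_{p+1}), up to vanishing terms.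
-- For R = suc R′ every order below reduces to a literal + m, so the comparisons happen in ℕ.
νOrder : ℕ → Bool → Bool → ℤ
νOrder R b₁ b₂ = (if b₁ then + R else 0ℤ) ℤ.+ (if b₂ then 0ℤ else + R ℤ.- + 1)

μFloor : ℕ → Bool → Bool → ℤ
μFloor R b₁ b₂ = (if b₁ then 0ℤ else + R) ℤ.+ (if b₂ then + suc R else 0ℤ)

νOrder≤boxOrder+μFloor : ∀ R b₁ b₂ → νOrder R b₁ b₂ ℤ.≤ boxOrder R ℤ.+ μFloor R b₁ b₂
νOrder≤boxOrder+μFloor zero    true  false = ℤP.≤-refl
νOrder≤boxOrder+μFloor zero    false true  = +≤+ z≤n
νOrder≤boxOrder+μFloor zero    true  true  = +≤+ z≤n
νOrder≤boxOrder+μFloor zero    false false = ℤP.≤-refl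
νOrder≤boxOrder+μFloor (suc R) true  false = +≤+ (ℕP.≤-reflexive (sym (trans (ℕP.+-identityʳ _) (ℕP.+-suc R R))))
νOrder≤boxOrder+μFloor (suc R) false true  = +≤+ z≤n
νOrder≤boxOrder+μFloor (suc R) true  true  =
  +≤+ (ℕP.≤-trans (ℕP.≤-reflexive (ℕP.+-identityʳ (suc R))) (ℕP.≤-trans (ℕP.m≤n+m (suc R) R) (ℕP.m≤m+n _ _)))
νOrder≤boxOrder+μFloor (suc R) false false = +≤+ (ℕP.≤-trans (ℕP.m≤m+n R (suc R)) (ℕP.m≤m+n _ _))

νOrder-+−≤μFloor-−+ : ∀ R → νOrder R true false ℤ.≤ μFloor R false true
νOrder-+−≤μFloor-−+ zero    = -≤+
νOrder-+−≤μFloor-−+ (suc R) = +≤+ (s≤s (ℕP.+-monoʳ-≤ R (ℕP.≤-trans (ℕP.n≤1+n R) (ℕP.n≤1+n (suc R)))))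

νOrder≤-1+μFloor : ∀ R b₁ b₂ → (b₁ ≡ true → b₂ ≡ true) → νOrder R b₁ b₂ ℤ.≤ ℤ.- + 1 ℤ.+ μFloor R b₁ b₂
νOrder≤-1+μFloor R       true  false ¬+− with () ← ¬+− refl
νOrder≤-1+μFloor zero    false true  _ = ℤP.≤-refl
νOrder≤-1+μFloor (suc R) false true  _ = +≤+ z≤n
νOrder≤-1+μFloor R       true  true  _ = +≤+ (ℕP.≤-reflexive (ℕP.+-identityʳ R))
νOrder≤-1+μFloor zero    false false _ = ℤP.≤-refl
νOrder≤-1+μFloor (suc R) false false _ = +≤+ (ℕP.≤-reflexive (sym (ℕP.+-identityʳ R)))

one-or-suc : ∀ {i} → 1 ≤ i → i ≡ 1 ⊎ Σ ℕ (λ i′ → i ≡ suc i′ × 1 ≤ i′)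
one-or-suc {suc zero}    _ = inj₁ refl
one-or-suc {suc (suc i)} _ = inj₂ (suc i , refl , s≤s z≤n)

-- The weight r_λ(ε), with an arbitrary row-length function ρ in place of i ↦ λ_i

module ShapeWeight (k : ℕ) (r : ℕ → ℕ → ℕ) where

  aPosRow : ℕ → ℕ → ℕ
  aPosRow ℓ i = if i ≤ᵇ k then (k + ℓ + 1) ∸ i else 0

  rrRow : ℕ → ℕ → ℕ → ℕ
  rrRow ℓ i j = if (1 ≤ᵇ i) ∧ (i ≤ᵇ k) ∧ (1 ≤ᵇ j) ∧ (j ≤ᵇ ℓ) then r i j else 0

  -- the i-th case in the definition of r_t, when rows i and i + 1 have lengths ℓ and ℓ′
  entry : ℕ → ℕ → Bool → ℕ → ℕ → Maybe ℤ
  entry ℓ ℓ′ b t i =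
    if (t ≡ᵇ aPosRow ℓ i) ∧ not b then just (+ rrRow ℓ i ℓ ℤ.- + 1)
    else (if (aPosRow ℓ′ (suc i) <ᵇ t) ∧ (t <ᵇ aPosRow ℓ i) ∧ b
            then just (+ rrRow ℓ i ((t + i) ∸ k)) else nothing)

  aPosOf : (ℕ → ℕ) → ℕ → ℕ
  aPosOf ρ i = aPosRow (ρ i) i

  rrOf : (ℕ → ℕ) → ℕ → ℕ → ℕ
  rrOf ρ i = rrRow (ρ i) i

  rtOf : (ℕ → ℕ) → Bool → ℕ → ℤ
  rtOf ρ b t = pick (map (λ i → entry (ρ i) (ρ (suc i)) b t i) (oneTo k))

  -- weightOf (row lam) is weight lam r by definition
  weightOf : ∀ {n} → (ℕ → ℕ) → Vec Bool n → ℤ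
  weightOf {n} ρ η = sumℤ (map (λ t → rtOf ρ (sgn η t) t) (oneTo n))

  weightOf-cong : ∀ {n} {ρ ρ′ : ℕ → ℕ} → (∀ i → ρ i ≡ ρ′ i) → (η : Vec Bool n) → weightOf ρ η ≡ weightOf ρ′ η
  weightOf-cong {n} ρ≗ρ′ η = cong sumℤ (ListP.map-cong (λ t → cong pick (ListP.map-cong
    (λ i → cong₂ (λ ℓ ℓ′ → entry ℓ ℓ′ (sgn η t) t i) (ρ≗ρ′ i) (ρ≗ρ′ (suc i))) (oneTo k))) (oneTo n))

  Invariant : ∀ {n} → (ℕ → ℕ) → ℕ → ℕ → M n → Set
  Invariant ρ L H x = (∀ η → Ord≥ (weightOf ρ η) (x η)) × (∀ η → Violates L H η → IsZero (x η))

  invariant-transport : ∀ {n} {ρ ρ′ L H L′ H′} {x : M n} → (∀ i → ρ i ≡ ρ′ i) → L′ ≤ L → H ≤ H′ →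
                        Invariant ρ L H x → Invariant ρ′ L′ H′ x
  invariant-transport {x = x} ρ≗ρ′ L′≤L H≤H′ (bound , support) =
    (λ η → subst (λ m → Ord≥ m (x η)) (weightOf-cong ρ≗ρ′ η) (bound η)) ,
    (λ η violation → support η (violates-weaken η L′≤L H≤H′ violation))

  Decreasing : (ℕ → ℕ) → Set
  Decreasing ρ = ∀ {i i′} → 1 ≤ i → i ≤ i′ → i′ ≤ k → ρ i′ ≤ ρ i

  aPosRow-≤ : ∀ ℓ {i} → i ≤ k → aPosRow ℓ i ≡ k ∸ i + ℓ + 1
  aPosRow-≤ ℓ {i} i≤k rewrite ≤ᵇ-true i≤k =
    trans (ℕP.+-∸-comm 1 (ℕP.≤-trans i≤k (ℕP.m≤m+n k ℓ))) (cong (_+ 1) (ℕP.+-∸-comm ℓ i≤k))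

  aPosRow-> : ∀ ℓ {i} → k < i → aPosRow ℓ i ≡ 0
  aPosRow-> ℓ k<i rewrite ≤ᵇ-false (ℕP.<⇒≱ k<i) = refl

  aPosOf-< : ∀ {ρ} → Decreasing ρ → ∀ {i i′} → 1 ≤ i → i < i′ → i′ ≤ suc k → aPosOf ρ i′ < aPosOf ρ i
  aPosOf-< {ρ} dec {i} {i′} 1≤i i<i′ i′≤sk with ℕP.m≤n⇒m<n∨m≡n i′≤sk
  ... | inj₂ refl rewrite aPosRow-> (ρ (suc k)) (ℕP.n<1+n k) | aPosRow-≤ (ρ i) (ℕP.≤-pred i<i′) =
    ℕP.<-≤-trans (s≤s z≤n) (ℕP.≤-reflexive (ℕP.+-comm 1 _))
  ... | inj₁ (s≤s i′≤k) rewrite aPosRow-≤ (ρ i′) i′≤k | aPosRow-≤ (ρ i) (ℕP.≤-trans (ℕP.<⇒≤ i<i′) i′≤k) =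
    ℕP.+-monoˡ-< 1 (ℕP.+-mono-<-≤ (ℕP.∸-monoʳ-< i<i′ i′≤k) (dec 1≤i (ℕP.<⇒≤ i<i′) i′≤k))

  aPosOf-≤ : ∀ {ρ} → Decreasing ρ → ∀ {i i′} → 1 ≤ i → i ≤ i′ → i′ ≤ suc k → aPosOf ρ i′ ≤ aPosOf ρ i
  aPosOf-≤ dec 1≤i i≤i′ i′≤sk with ℕP.m≤n⇒m<n∨m≡n i≤i′
  ... | inj₁ i<i′ = ℕP.<⇒≤ (aPosOf-< dec 1≤i i<i′ i′≤sk)
  ... | inj₂ refl = ℕP.≤-refl

  module _ {ℓ ℓ′ : ℕ} {i : ℕ} where

    entry-nothing : ∀ {b t} → t ≢ aPosRow ℓ i → ¬ (aPosRow ℓ′ (suc i) < t × t < aPosRow ℓ i) →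
                    entry ℓ ℓ′ b t i ≡ nothing
    entry-nothing {b} {t} t≢a ¬inside rewrite ≡ᵇ-false t≢a
      with aPosRow ℓ′ (suc i) <? t | t <? aPosRow ℓ i
    ... | no a′≮t   | _        rewrite <ᵇ-false a′≮t = refl
    ... | yes a′<t  | no t≮a   rewrite <ᵇ-true a′<t | <ᵇ-false t≮a = refl
    ... | yes a′<t  | yes t<a  = ⊥-elim (¬inside (a′<t , t<a))

    entry-at-aPos : ∀ b → entry ℓ ℓ′ b (aPosRow ℓ i) i ≡ (if b then nothing else just (+ rrRow ℓ i ℓ ℤ.- + 1))
    entry-at-aPos false rewrite ≡ᵇ-true {aPosRow ℓ i} refl = refl
    entry-at-aPos true  rewrite ≡ᵇ-true {aPosRow ℓ i} refl | <ᵇ-false (ℕP.<-irrefl {aPosRow ℓ i} refl)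
                              | ∧-zeroʳ (aPosRow ℓ′ (suc i) <ᵇ aPosRow ℓ i) = refl

    entry-inside : ∀ {b t} → aPosRow ℓ′ (suc i) < t → t < aPosRow ℓ i →
                   entry ℓ ℓ′ b t i ≡ (if b then just (+ rrRow ℓ i ((t + i) ∸ k)) else nothing)
    entry-inside a′<t t<a rewrite ≡ᵇ-false (ℕP.<⇒≢ t<a) | <ᵇ-true a′<t | <ᵇ-true t<a = refl

  rtOf-located : ∀ {ρ} → Decreasing ρ → ∀ b t {i} → 1 ≤ i → i ≤ k → aPosOf ρ (suc i) < t → t ≤ aPosOf ρ i →
                 rtOf ρ b t ≡ fromMaybe 0ℤ (entry (ρ i) (ρ (suc i)) b t i)
  rtOf-located {ρ} dec b t {i} 1≤i i≤k a[i+1]<t t≤a[i] =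
    pick-unique (λ i → entry (ρ i) (ρ (suc i)) b t i) (oneTo k) (∈-oneTo 1≤i i≤k)
      (All.tabulate (λ {i′} i′∈ → only-i (∈-oneTo⁻ i′∈)))
    where
    only-i : ∀ {i′} → 1 ≤ i′ × i′ ≤ k → entry (ρ i′) (ρ (suc i′)) b t i′ ≡ nothing ⊎ i′ ≡ i
    only-i {i′} (1≤i′ , i′≤k) with ℕP.<-cmp i′ i
    ... | tri≈ _ i′≡i _ = inj₂ i′≡i
    ... | tri< i′<i _ _ = inj₁ (entry-nothing (ℕP.<⇒≢ t<a[i′]) (λ (a<t , _) → ℕP.<⇒≱ a<t t≤a[i′+1]))
      where
      t<a[i′] : t < aPosOf ρ i′
      t<a[i′] = ℕP.≤-<-trans t≤a[i] (aPosOf-< dec 1≤i′ i′<i (ℕP.m≤n⇒m≤1+n i≤k))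
      t≤a[i′+1] : t ≤ aPosOf ρ (suc i′)
      t≤a[i′+1] = ℕP.≤-trans t≤a[i] (aPosOf-≤ dec (s≤s z≤n) i′<i (ℕP.m≤n⇒m≤1+n i≤k))
    ... | tri> _ _ i<i′ = inj₁ (entry-nothing (ℕP.>⇒≢ a[i′]<t) (λ (_ , t<a) → ℕP.<-asym t<a a[i′]<t))
      where
      a[i′]<t : aPosOf ρ i′ < t
      a[i′]<t = ℕP.≤-<-trans (aPosOf-≤ dec (s≤s z≤n) i<i′ (ℕP.m≤n⇒m≤1+n i′≤k)) a[i+1]<t

  rtOf-above : ∀ {ρ} → Decreasing ρ → ∀ b t → aPosOf ρ 1 < t → rtOf ρ b t ≡ 0ℤ
  rtOf-above {ρ} dec b t a[1]<t =
    pick-nothing (λ i → entry (ρ i) (ρ (suc i)) b t i) (oneTo k)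
      (All.tabulate (λ i∈ → nothing-at (∈-oneTo⁻ i∈)))
    where
    nothing-at : ∀ {i} → 1 ≤ i × i ≤ k → entry (ρ i) (ρ (suc i)) b t i ≡ nothing
    nothing-at {i} (1≤i , i≤k) = entry-nothing (ℕP.>⇒≢ a[i]<t) (λ (_ , t<a) → ℕP.<-asym t<a a[i]<t)
      where
      a[i]<t : aPosOf ρ i < t
      a[i]<t = ℕP.≤-<-trans (aPosOf-≤ dec (s≤s z≤n) 1≤i (ℕP.m≤n⇒m≤1+n i≤k)) a[1]<t

  rtOf-at-aPos : ∀ {ρ} → Decreasing ρ → ∀ b {i} → 1 ≤ i → i ≤ k →
                 rtOf ρ b (aPosOf ρ i) ≡ (if b then 0ℤ else + rrOf ρ i (ρ i) ℤ.- + 1)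
  rtOf-at-aPos {ρ} dec b {i} 1≤i i≤k = trans
    (rtOf-located dec b (aPosOf ρ i) 1≤i i≤k (aPosOf-< dec 1≤i (ℕP.n<1+n i) (s≤s i≤k)) ℕP.≤-refl)
    (trans (cong (fromMaybe 0ℤ) (entry-at-aPos {ρ i} {ρ (suc i)} {i} b)) (fromMaybe-if b))
    where
    fromMaybe-if : ∀ b {x} → fromMaybe 0ℤ (if b then nothing else just x) ≡ (if b then 0ℤ else x)
    fromMaybe-if true  = refl
    fromMaybe-if false = refl

  rtOf-inside : ∀ {ρ} → Decreasing ρ → ∀ b {t i} → 1 ≤ i → i ≤ k → aPosOf ρ (suc i) < t → t < aPosOf ρ i →
                rtOf ρ b t ≡ (if b then + rrOf ρ i ((t + i) ∸ k) else 0ℤ)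
  rtOf-inside {ρ} dec b {t} {i} 1≤i i≤k a[i+1]<t t<a[i] = trans
    (rtOf-located dec b t 1≤i i≤k a[i+1]<t (ℕP.<⇒≤ t<a[i]))
    (trans (cong (fromMaybe 0ℤ) (entry-inside {ρ i} {ρ (suc i)} {i} {b} a[i+1]<t t<a[i])) (fromMaybe-if b))
    where
    fromMaybe-if : ∀ b {x} → fromMaybe 0ℤ (if b then just x else nothing) ≡ (if b then x else 0ℤ)
    fromMaybe-if true  = refl
    fromMaybe-if false = refl

  weightOf-empty : ∀ {n} (η : Vec Bool n) → weightOf (λ _ → 0) η ℤ.≤ 0ℤ
  weightOf-empty {n} η = sumℤ-≤0 _ (oneTo n) (λ t → pick-≤0 _ (oneTo k) (λ i →
    entry-≤0 ((t ≡ᵇ aPosRow 0 i) ∧ not (sgn η t)) ((aPosRow 0 (suc i) <ᵇ t) ∧ (t <ᵇ aPosRow 0 i) ∧ sgn η t)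
      (subst (λ z → + z ℤ.- + 1 ℤ.≤ 0ℤ) (sym (rrRow-empty i 0)) -≤+)
      (ℤP.≤-reflexive (cong +_ (rrRow-empty i ((t + i) ∸ k))))))
    where
    column-outside : ∀ j → (1 ≤ᵇ j) ∧ (j ≤ᵇ 0) ≡ false
    column-outside zero    = refl
    column-outside (suc j) = refl
    rrRow-empty : ∀ i j → rrRow 0 i j ≡ 0
    rrRow-empty i j rewrite column-outside j | ∧-zeroʳ (i ≤ᵇ k) | ∧-zeroʳ (1 ≤ᵇ i) = refl
    entry-≤0 : ∀ c₁ c₂ {x y} → x ℤ.≤ 0ℤ → y ℤ.≤ 0ℤ →
               Maybe.All (ℤ._≤ 0ℤ) (if c₁ then just x else (if c₂ then just y else nothing))
    entry-≤0 true  _     x≤0 _   = Maybe.just x≤0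
    entry-≤0 false true  _   y≤0 = Maybe.just y≤0
    entry-≤0 false false _   _   = Maybe.nothing

  rrRow-cong : ∀ {ℓ ℓ′ i j} → j ≤ ℓ → j ≤ ℓ′ → rrRow ℓ i j ≡ rrRow ℓ′ i j
  rrRow-cong {ℓ} {ℓ′} {i} {j} j≤ℓ j≤ℓ′ =
    cong (λ c → if (1 ≤ᵇ i) ∧ (i ≤ᵇ k) ∧ (1 ≤ᵇ j) ∧ c then r i j else 0)
         (trans (≤ᵇ-true j≤ℓ) (sym (≤ᵇ-true j≤ℓ′)))

  rrRow-inBox : ∀ {ℓ i j} → 1 ≤ i → i ≤ k → 1 ≤ j → j ≤ ℓ → rrRow ℓ i j ≡ r i j
  rrRow-inBox {ℓ} {i} {j} 1≤i i≤k 1≤j j≤ℓ =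
    cong (λ c → if c then r i j else 0)
         (cong₂ _∧_ (≤ᵇ-true 1≤i) (cong₂ _∧_ (≤ᵇ-true i≤k) (cong₂ _∧_ (≤ᵇ-true 1≤j) (≤ᵇ-true j≤ℓ))))

  entry-lower-cong : ∀ {ℓ ℓ′ ℓ″ b t i} → (aPosRow ℓ′ (suc i) <ᵇ t) ≡ (aPosRow ℓ″ (suc i) <ᵇ t) →
                     entry ℓ ℓ′ b t i ≡ entry ℓ ℓ″ b t i
  entry-lower-cong {ℓ} {b = b} {t} {i} =
    cong (λ below → if (t ≡ᵇ aPosRow ℓ i) ∧ not b then just (+ rrRow ℓ i ℓ ℤ.- + 1)
                    else (if below ∧ (t <ᵇ aPosRow ℓ i) ∧ b then just (+ rrRow ℓ i ((t + i) ∸ k)) else nothing))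

  -- Adding the box (i₀, j + 1) moves the plus of row i₀ from p = a_μ(i₀) to p + 1 = a_ν(i₀);
  -- the weight changes only at p and p + 1.
  module AddBox {μ ν : ℕ → ℕ} {i₀ j : ℕ} (1≤i₀ : 1 ≤ i₀) (i₀≤k : i₀ ≤ k)
    (μ-dec : Decreasing μ) (ν-dec : Decreasing ν)
    (μi₀≡j : μ i₀ ≡ j) (νi₀≡1+j : ν i₀ ≡ suc j) (ν≗μ : ∀ i → i ≢ i₀ → ν i ≡ μ i)
    (rows-above : ∀ {i} → 1 ≤ i → i < i₀ → suc j ≤ μ i) (rows-below : ∀ {i} → i₀ < i → μ i ≡ 0)
    where

    p : ℕ
    p = k ∸ i₀ + suc j

    1≤p : 1 ≤ p
    1≤p = ℕP.≤-trans (s≤s z≤n) (ℕP.m≤n+m (suc j) (k ∸ i₀))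

    aPosRow-i₀ : ∀ c → aPosRow c i₀ ≡ k ∸ i₀ + suc c
    aPosRow-i₀ c = trans (aPosRow-≤ c i₀≤k) (trans (ℕP.+-assoc (k ∸ i₀) c 1) (cong (λ z → k ∸ i₀ + z) (ℕP.+-comm c 1)))

    aPosRow-j : aPosRow j i₀ ≡ p
    aPosRow-j = aPosRow-i₀ j

    aPosRow-1+j : aPosRow (suc j) i₀ ≡ suc p
    aPosRow-1+j = trans (aPosRow-i₀ (suc j)) (ℕP.+-suc (k ∸ i₀) (suc j))

    aPosOf-below : ∀ {ρ} → ρ (suc i₀) ≡ 0 → aPosOf ρ (suc i₀) < p
    aPosOf-below {ρ} ρ[i₀+1]≡0 with suc i₀ ℕP.≤? k
    ... | no  i₀≮k = subst (_< p) (sym (aPosRow-> (ρ (suc i₀)) (ℕP.≰⇒> i₀≮k))) 1≤p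
    ... | yes i₀<k = begin-strict
      aPosRow (ρ (suc i₀)) (suc i₀)  ≡⟨ aPosRow-≤ (ρ (suc i₀)) i₀<k ⟩
      k ∸ suc i₀ + ρ (suc i₀) + 1    ≡⟨ cong (λ ℓ → k ∸ suc i₀ + ℓ + 1) ρ[i₀+1]≡0 ⟩
      k ∸ suc i₀ + 0 + 1             ≡⟨ trans (cong (_+ 1) (ℕP.+-identityʳ _)) (ℕP.+-comm _ 1) ⟩
      suc (k ∸ suc i₀)               ≡⟨ sym (ℕP.+-∸-assoc 1 i₀<k) ⟩
      k ∸ i₀                         <⟨ ℕP.m<m+n (k ∸ i₀) (s≤s z≤n) ⟩
      p                              ∎
      where open ℕP.≤-Reasoning

    μ[i₀+1]≡0 : μ (suc i₀) ≡ 0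
    μ[i₀+1]≡0 = rows-below (ℕP.n<1+n i₀)

    ν[i₀+1]≡0 : ν (suc i₀) ≡ 0
    ν[i₀+1]≡0 = trans (ν≗μ (suc i₀) (ℕP.1+n≢n)) μ[i₀+1]≡0

    aPosOf-μ-i₀ : aPosOf μ i₀ ≡ p
    aPosOf-μ-i₀ = trans (cong (λ ℓ → aPosRow ℓ i₀) μi₀≡j) aPosRow-j

    aPosOf-ν-i₀ : aPosOf ν i₀ ≡ suc p
    aPosOf-ν-i₀ = trans (cong (λ ℓ → aPosRow ℓ i₀) νi₀≡1+j) aPosRow-1+j

    p+i₀≡k+1+j : p + i₀ ≡ k + suc j
    p+i₀≡k+1+j = begin
      p + i₀                  ≡⟨ ℕP.+-comm p i₀ ⟩
      i₀ + (k ∸ i₀ + suc j)   ≡⟨ sym (ℕP.+-assoc i₀ (k ∸ i₀) (suc j)) ⟩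
      i₀ + (k ∸ i₀) + suc j   ≡⟨ cong (_+ suc j) (ℕP.m+[n∸m]≡n i₀≤k) ⟩
      k + suc j               ∎
      where open ≡-Reasoning

    column-p : (p + i₀) ∸ k ≡ suc j
    column-p = trans (cong (_∸ k) p+i₀≡k+1+j) (ℕP.m+n∸m≡n k (suc j))

    rtOf-ν-p : ∀ b → rtOf ν b p ≡ (if b then + rrOf ν i₀ (suc j) else 0ℤ)
    rtOf-ν-p b = trans
      (rtOf-inside ν-dec b 1≤i₀ i₀≤k (aPosOf-below {ν} ν[i₀+1]≡0) (subst (p <_) (sym aPosOf-ν-i₀) (ℕP.n<1+n p)))
      (cong (λ c → if b then + rrOf ν i₀ c else 0ℤ) column-p)

    rtOf-ν-1+p : ∀ b → rtOf ν b (suc p) ≡ (if b then 0ℤ else + rrOf ν i₀ (suc j) ℤ.- + 1)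
    rtOf-ν-1+p b = subst₂ (λ t c → rtOf ν b t ≡ (if b then 0ℤ else + rrOf ν i₀ c ℤ.- + 1))
      aPosOf-ν-i₀ νi₀≡1+j (rtOf-at-aPos ν-dec b 1≤i₀ i₀≤k)

    rtOf-μ-p : ∀ b → rtOf μ b p ≡ (if b then 0ℤ else + rrOf μ i₀ j ℤ.- + 1)
    rtOf-μ-p b = subst₂ (λ t c → rtOf μ b t ≡ (if b then 0ℤ else + rrOf μ i₀ c ℤ.- + 1))
      aPosOf-μ-i₀ μi₀≡j (rtOf-at-aPos μ-dec b 1≤i₀ i₀≤k)

    rtOf-μ-1+p-top : i₀ ≡ 1 → ∀ b → rtOf μ b (suc p) ≡ 0ℤ
    rtOf-μ-1+p-top refl b = rtOf-above μ-dec b (suc p) (subst (_< suc p) (sym aPosOf-μ-i₀) (ℕP.n<1+n p))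

    rtOf-μ-1+p : ∀ {i′} → i₀ ≡ suc i′ → 1 ≤ i′ → ∀ b → rtOf μ b (suc p) ≡ (if b then + rrOf μ i′ (suc j) else 0ℤ)
    rtOf-μ-1+p {i′} refl 1≤i′ b = trans
      (rtOf-inside μ-dec b 1≤i′ (ℕP.<⇒≤ i₀≤k) (subst (_< suc p) (sym aPosOf-μ-i₀) (ℕP.n<1+n p)) 1+p<a[i′])
      (cong (λ c → if b then + rrOf μ i′ c else 0ℤ) (trans (cong (_∸ k) (sym (ℕP.+-suc p i′))) column-p))
      where
      1+p<a[i′] : suc p < aPosOf μ i′
      1+p<a[i′] = begin-strict
        suc p                             <⟨ ℕP.m<m+n (suc p) (s≤s z≤n) ⟩
        suc (k ∸ suc i′) + suc j + 1      ≤⟨ ℕP.+-monoˡ-≤ 1 (ℕP.+-monoʳ-≤ (suc (k ∸ suc i′)) (rows-above 1≤i′ (ℕP.n<1+n i′))) ⟩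
        suc (k ∸ suc i′) + μ i′ + 1       ≡⟨ cong (λ z → z + μ i′ + 1) (sym (ℕP.+-∸-assoc 1 i₀≤k)) ⟩
        k ∸ i′ + μ i′ + 1                 ≡⟨ sym (aPosRow-≤ (μ i′) (ℕP.<⇒≤ i₀≤k)) ⟩
        aPosOf μ i′                       ∎
        where open ℕP.≤-Reasoning

    entry-grow : ∀ ℓ′ b t → t ≢ p → t ≢ suc p → entry (suc j) ℓ′ b t i₀ ≡ entry j ℓ′ b t i₀
    entry-grow ℓ′ b t t≢p t≢1+p with aPosRow ℓ′ (suc i₀) <? t | t <? p
    ... | yes a′<t | yes t<p = begin
      entry (suc j) ℓ′ b t i₀                        ≡⟨ entry-inside a′<t (subst (t <_) (sym aPosRow-1+j) (ℕP.m<n⇒m<1+n t<p)) ⟩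
      (if b then just (+ rrRow (suc j) i₀ c) else nothing) ≡⟨ cong (λ z → if b then just (+ z) else nothing)
                                                              (rrRow-cong (ℕP.m≤n⇒m≤1+n c≤j) c≤j) ⟩
      (if b then just (+ rrRow j i₀ c) else nothing)  ≡⟨ sym (entry-inside a′<t (subst (t <_) (sym aPosRow-j) t<p)) ⟩
      entry j ℓ′ b t i₀                               ∎
      where
      open ≡-Reasoning
      c : ℕ
      c = (t + i₀) ∸ k
      c≤j : c ≤ j
      c≤j = ℕP.m≤n+o⇒m∸n≤o (t + i₀) k (ℕP.≤-pred (subst (suc (t + i₀) ≤_) (trans p+i₀≡k+1+j (ℕP.+-suc k j))
                                                     (ℕP.+-monoˡ-< i₀ t<p)))
    ... | no a′≮t | _ = trans (entry-nothing (subst (t ≢_) (sym aPosRow-1+j) t≢1+p) (λ (a′<t , _) → a′≮t a′<t))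
                              (sym (entry-nothing (subst (t ≢_) (sym aPosRow-j) t≢p) (λ (a′<t , _) → a′≮t a′<t)))
    ... | yes _ | no t≮p = trans (entry-nothing (subst (t ≢_) (sym aPosRow-1+j) t≢1+p) t≮1+p)
                                 (sym (entry-nothing (subst (t ≢_) (sym aPosRow-j) t≢p) (λ (_ , t<a) → t≮p (subst (t <_) aPosRow-j t<a))))
      where
      t≮1+p : ¬ (_ × t < aPosRow (suc j) i₀)
      t≮1+p (_ , t<a) = t≮p (ℕP.≤∧≢⇒< (ℕP.≤-pred (subst (t <_) aPosRow-1+j t<a)) t≢p)

    lower-test : ∀ t → t ≢ suc p → (aPosRow (suc j) i₀ <ᵇ t) ≡ (aPosRow j i₀ <ᵇ t)
    lower-test t t≢1+p rewrite aPosRow-1+j | aPosRow-j with p <? t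
    ... | yes p<t = trans (<ᵇ-true (ℕP.≤∧≢⇒< p<t (t≢1+p ∘ sym))) (sym (<ᵇ-true p<t))
    ... | no  p≮t = trans (<ᵇ-false (p≮t ∘ ℕP.<-trans (ℕP.n<1+n p))) (sym (<ᵇ-false p≮t))

    entry-ν≡μ : ∀ b t → t ≢ p → t ≢ suc p → ∀ i → entry (ν i) (ν (suc i)) b t i ≡ entry (μ i) (μ (suc i)) b t i
    entry-ν≡μ b t t≢p t≢1+p i with i ≟ i₀ | suc i ≟ i₀
    ... | yes refl | _ rewrite νi₀≡1+j | μi₀≡j | ν≗μ (suc i) ℕP.1+n≢n = entry-grow (μ (suc i)) b t t≢p t≢1+p
    ... | no i≢i₀ | yes 1+i≡i₀ rewrite ν≗μ i i≢i₀ | trans (cong ν 1+i≡i₀) νi₀≡1+j | trans (cong μ 1+i≡i₀) μi₀≡j =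
      entry-lower-cong {μ i} {suc j} {j} {b} {t} {i}
        (subst (λ i₀ → (aPosRow (suc j) i₀ <ᵇ t) ≡ (aPosRow j i₀ <ᵇ t)) (sym 1+i≡i₀) (lower-test t t≢1+p))
    ... | no i≢i₀ | no 1+i≢i₀ = cong₂ (λ ℓ ℓ′ → entry ℓ ℓ′ b t i) (ν≗μ i i≢i₀) (ν≗μ (suc i) 1+i≢i₀)

    rtOf-ν≡μ : ∀ b t → t ≢ p → t ≢ suc p → rtOf ν b t ≡ rtOf μ b t
    rtOf-ν≡μ b t t≢p t≢1+p = cong pick (ListP.map-cong (entry-ν≡μ b t t≢p t≢1+p) (oneTo k))

    -- the rows below i₀, and row i₀ while it is empty, keep their pluses at 1, …, L;
    -- no plus has moved beyond H = k + (length of the first row)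
    Lμ Hμ Lν Hν : ℕ
    Lμ = k ∸ i₀ + (1 ∸ j)
    Hμ = k + μ 1
    Lν = k ∸ i₀ + (1 ∸ suc j)
    Hν = k + ν 1

    p≤Lμ : j ≡ 0 → p ≤ Lμ
    p≤Lμ refl = ℕP.≤-refl

    Hμ≤p : i₀ ≡ 1 → Hμ ≤ p
    Hμ≤p refl = ℕP.≤-reflexive (begin
      k + μ 1           ≡⟨ cong (λ z → k + z) μi₀≡j ⟩
      k + j             ≡⟨ cong (_+ j) (sym (ℕP.m∸n+n≡m i₀≤k)) ⟩
      k ∸ 1 + 1 + j     ≡⟨ ℕP.+-assoc (k ∸ 1) 1 j ⟩
      k ∸ 1 + suc j     ∎)
      where open ≡-Reasoning

    Lν<p : Lν < p
    Lν<p = subst (_< p) (cong (λ z → k ∸ i₀ + z) (sym (ℕP.0∸n≡0 j))) (ℕP.+-monoʳ-< (k ∸ i₀) (s≤s z≤n))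

    μ1≤ν1 : μ 1 ≤ ν 1
    μ1≤ν1 with one-or-suc 1≤i₀
    ... | inj₁ refl = subst₂ _≤_ (sym μi₀≡j) (sym νi₀≡1+j) (ℕP.n≤1+n j)
    ... | inj₂ (i′ , refl , 1≤i′) = ℕP.≤-reflexive (sym (ν≗μ 1 (λ 1≡i₀ → ℕP.<-irrefl 1≡i₀ (s≤s 1≤i′))))

    1+j≤ν1 : suc j ≤ ν 1
    1+j≤ν1 with one-or-suc 1≤i₀
    ... | inj₁ refl = ℕP.≤-reflexive (sym νi₀≡1+j)
    ... | inj₂ (i′ , refl , 1≤i′) =
      subst (suc j ≤_) (sym (ν≗μ 1 (λ 1≡i₀ → ℕP.<-irrefl 1≡i₀ (s≤s 1≤i′)))) (rows-above ℕP.≤-refl (s≤s 1≤i′))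

    1+p≤Hν : suc p ≤ Hν
    1+p≤Hν = ℕP.+-mono-≤ (ℕP.∸-monoʳ-< {o = 0} 1≤i₀ i₀≤k) 1+j≤ν1

    Lν≤Lμ : Lν ≤ Lμ
    Lν≤Lμ = ℕP.+-monoʳ-≤ (k ∸ i₀) (ℕP.∸-monoʳ-≤ 1 (ℕP.n≤1+n j))

    Hμ≤Hν : Hμ ≤ Hν
    Hμ≤Hν = ℕP.+-monoʳ-≤ k μ1≤ν1

    module _ {n : ℕ} (1+p≤n : suc p ≤ n) where

      rtAt : (ℕ → ℕ) → Vec Bool n → ℕ → ℤ
      rtAt ρ η t = rtOf ρ (sgn η t) t

      rest : Vec Bool n → ℤ
      rest η = sumℤ (map ((rtAt ν η ∖ suc p) ∖ p) (oneTo n))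

      weightOf-ν-split : ∀ η → weightOf ν η ≡ rest η ℤ.+ (rtOf ν (sgn η p) p ℤ.+ rtOf ν (sgn η (suc p)) (suc p))
      weightOf-ν-split η = sumℤ-split-pair (rtAt ν η) n p 1≤p 1+p≤n

      weightOf-μ-split : ∀ η → weightOf μ η ≡ rest η ℤ.+ (rtOf μ (sgn η p) p ℤ.+ rtOf μ (sgn η (suc p)) (suc p))
      weightOf-μ-split η = trans (sumℤ-split-pair (rtAt μ η) n p 1≤p 1+p≤n)
        (cong (ℤ._+ (rtOf μ (sgn η p) p ℤ.+ rtOf μ (sgn η (suc p)) (suc p)))
              (sumℤ-∖-pair-cong (rtAt μ η) (rtAt ν η) p (oneTo n)
                 (λ t t≢p t≢1+p → sym (rtOf-ν≡μ (sgn η t) t t≢p t≢1+p))))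

      rest-swapAt : ∀ η → rest (swapAt p η) ≡ rest η
      rest-swapAt η = sumℤ-∖-pair-cong (rtAt ν (swapAt p η)) (rtAt ν η) p (oneTo n)
        (λ t t≢p t≢1+p → cong (λ b → rtOf ν b t) (sgn-swapAt-other p η t t≢p t≢1+p))

      module Valuation (R : ℕ) (rrν≡R : rrOf ν i₀ (suc j) ≡ R)
        (R<left : 1 ≤ j → R < rrOf μ i₀ j) (R<above : ∀ {i′} → i₀ ≡ suc i′ → 1 ≤ i′ → R < rrOf μ i′ (suc j))
        (c : Qv) (c-order : Ord≥ (boxOrder R) c)
        (x : M n) (x-invariant : Invariant μ Lμ Hμ x)
        where

        x-bound : ∀ η → Ord≥ (weightOf μ η) (x η)
        x-bound = proj₁ x-invariant

        x-support : ∀ η → Violates Lμ Hμ η → IsZero (x η)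
        x-support = proj₂ x-invariant

        y : M n
        y η = T p x η +F (c *F x η)

        -- A minus at p contributes r_{i₀ j} - 1 ≥ R, except for j = 0, where p ≤ Lμ.
        -- A plus at p + 1 contributes r_{i₀-1, j+1} ≥ R + 1, except for i₀ = 1, where p + 1 > Hμ.
        floor-p : ∀ η → IsZero (x η) ⊎ (if sgn η p then 0ℤ else + R) ℤ.≤ rtOf μ (sgn η p) p
        floor-p η with sgn η p in ε-p | j ≟ 0
        ... | true  | _      = inj₂ (ℤP.≤-reflexive (sym (rtOf-μ-p true)))
        ... | false | yes j≡0 = inj₁ (x-support η (inj₁ (p , 1≤p , p≤Lμ j≡0 , ε-p)))
        ... | false | no  j≢0 =
          inj₂ (ℤP.≤-trans (R≤rr-1 (R<left (ℕP.n≢0⇒n>0 j≢0))) (ℤP.≤-reflexive (sym (rtOf-μ-p false))))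
          where
          R≤rr-1 : ∀ {u} → R < u → + R ℤ.≤ + u ℤ.- + 1
          R≤rr-1 {suc u} (s≤s R≤u) = +≤+ R≤u

        floor-1+p : ∀ η → IsZero (x η) ⊎ (if sgn η (suc p) then + suc R else 0ℤ) ℤ.≤ rtOf μ (sgn η (suc p)) (suc p)
        floor-1+p η with sgn η (suc p) in ε-1+p | one-or-suc 1≤i₀
        ... | false | inj₁ i₀≡1               = inj₂ (ℤP.≤-reflexive (sym (rtOf-μ-1+p-top i₀≡1 false)))
        ... | false | inj₂ (i′ , i₀≡1+i′ , 1≤i′) = inj₂ (ℤP.≤-reflexive (sym (rtOf-μ-1+p i₀≡1+i′ 1≤i′ false)))
        ... | true  | inj₁ i₀≡1               = inj₁ (x-support η (inj₂ (suc p , s≤s (Hμ≤p i₀≡1) , ε-1+p)))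
        ... | true  | inj₂ (i′ , i₀≡1+i′ , 1≤i′) =
          inj₂ (ℤP.≤-trans (+≤+ (R<above i₀≡1+i′ 1≤i′)) (ℤP.≤-reflexive (sym (rtOf-μ-1+p i₀≡1+i′ 1≤i′ true))))

        x-floor : ∀ η {b₁ b₂} → sgn η p ≡ b₁ → sgn η (suc p) ≡ b₂ → Ord≥ (rest η ℤ.+ μFloor R b₁ b₂) (x η)
        x-floor η refl refl with floor-p η | floor-1+p η
        ... | inj₁ x≡0 | _       = vanishing x≡0
        ... | inj₂ _   | inj₁ x≡0 = vanishing x≡0
        ... | inj₂ f₁  | inj₂ f₂  = Ord≥-mono (x η)
          (ℤP.≤-trans (ℤP.+-monoʳ-≤ (rest η) (ℤP.+-mono-≤ f₁ f₂)) (ℤP.≤-reflexive (sym (weightOf-μ-split η))))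
          (x-bound η)

        x-floor-swapped : ∀ η {b₁ b₂} → sgn η p ≡ b₁ → sgn η (suc p) ≡ b₂ →
                          Ord≥ (rest η ℤ.+ μFloor R b₂ b₁) (x (swapAt p η))
        x-floor-swapped η {b₁} {b₂} ε-p ε-1+p =
          subst (λ m → Ord≥ (m ℤ.+ μFloor R b₂ b₁) (x (swapAt p η))) (rest-swapAt η)
            (x-floor (swapAt p η) (trans (sgn-swapAt-left p η 1≤p 1+p≤n) ε-1+p)
                                  (trans (sgn-swapAt-right p η 1≤p 1+p≤n) ε-p))

        weightOf-ν : ∀ η {b₁ b₂} → sgn η p ≡ b₁ → sgn η (suc p) ≡ b₂ → weightOf ν η ≡ rest η ℤ.+ νOrder R b₁ b₂
        weightOf-ν η {b₁} {b₂} ε-p ε-1+p = trans (weightOf-ν-split η) (cong (λ z → rest η ℤ.+ z) (cong₂ ℤ._+_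
          (trans (cong (λ b → rtOf ν b p) ε-p) (trans (rtOf-ν-p b₁) (cong (λ R → if b₁ then + R else 0ℤ) rrν≡R)))
          (trans (cong (λ b → rtOf ν b (suc p)) ε-1+p)
                 (trans (rtOf-ν-1+p b₂) (cong (λ R → if b₂ then 0ℤ else + R ℤ.- + 1) rrν≡R)))))

        T-bound : ∀ η {b₁ b₂} → sgn η p ≡ b₁ → sgn η (suc p) ≡ b₂ → Ord≥ (rest η ℤ.+ νOrder R b₁ b₂) (T p x η)
        T-bound η {true} {false} ε-p ε-1+p = subst (Ord≥ (rest η ℤ.+ νOrder R true false)) (sym (T-+− p x η ε-p ε-1+p))
          (Ord≥-shift {rest η} (x (swapAt p η)) (νOrder-+−≤μFloor-−+ R) (x-floor-swapped η ε-p ε-1+p))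
        T-bound η {false} {true} ε-p ε-1+p = subst (Ord≥ (rest η ℤ.+ νOrder R false true)) (sym (T-−+ p x η ε-p ε-1+p))
          (Ord≥-+ (x (swapAt p η)) ((vF -F v⁻¹F) *F x η) (x-floor-swapped η ε-p ε-1+p)
            (Ord≥-scale {m = rest η} (vF -F v⁻¹F) (x η) Ord≥-v-v⁻¹ (x-floor η ε-p ε-1+p)
                        (νOrder≤-1+μFloor R false true (λ ()))))
        T-bound η {true} {true} ε-p ε-1+p = subst (Ord≥ (rest η ℤ.+ νOrder R true true)) (sym (T-++ p x η ε-p ε-1+p))
          (Ord≥-scale {m = rest η} (-F v⁻¹F) (x η) Ord≥-neg-v⁻¹ (x-floor η ε-p ε-1+p)
                      (νOrder≤-1+μFloor R true true (λ _ → refl)))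
        T-bound η {false} {false} ε-p ε-1+p = subst (Ord≥ (rest η ℤ.+ νOrder R false false)) (sym (T-−− p x η ε-p ε-1+p))
          (Ord≥-scale {m = rest η} (-F v⁻¹F) (x η) Ord≥-neg-v⁻¹ (x-floor η ε-p ε-1+p)
                      (νOrder≤-1+μFloor R false false (λ ())))

        y-bound : ∀ η → Ord≥ (weightOf ν η) (y η)
        y-bound η = subst (λ m → Ord≥ m (y η)) (sym (weightOf-ν η refl refl))
          (Ord≥-+ (T p x η) (c *F x η) (T-bound η refl refl)
            (Ord≥-scale {m = rest η} c (x η) c-order (x-floor η refl refl)
                        (νOrder≤boxOrder+μFloor R (sgn η p) (sgn η (suc p)))))

        y-support : ∀ η → Violates Lν Hν η → IsZero (y η)
        y-support η violation = isZero-+ (T p x η) (c *F x η) (T-zero refl refl) (isZero-* c (x η) x≡0)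
          where
          x≡0 : IsZero (x η)
          x≡0 = x-support η (violates-weaken η Lν≤Lμ Hμ≤Hν violation)
          xs≡0 : IsZero (x (swapAt p η))
          xs≡0 = x-support (swapAt p η) (violates-swapAt p η Lν≤Lμ Hμ≤Hν Lν<p 1+p≤Hν violation)
          T-zero : ∀ {b₁ b₂} → sgn η p ≡ b₁ → sgn η (suc p) ≡ b₂ → IsZero (T p x η)
          T-zero {true}  {false} ε-p ε-1+p = subst IsZero (sym (T-+− p x η ε-p ε-1+p)) xs≡0
          T-zero {false} {true}  ε-p ε-1+p = subst IsZero (sym (T-−+ p x η ε-p ε-1+p))
            (isZero-+ (x (swapAt p η)) ((vF -F v⁻¹F) *F x η) xs≡0 (isZero-* (vF -F v⁻¹F) (x η) x≡0))
          T-zero {true}  {true}  ε-p ε-1+p = subst IsZero (sym (T-++ p x η ε-p ε-1+p)) (isZero-* (-F v⁻¹F) (x η) x≡0)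
          T-zero {false} {false} ε-p ε-1+p = subst IsZero (sym (T-−− p x η ε-p ε-1+p)) (isZero-* (-F v⁻¹F) (x η) x≡0)

        y-invariant : Invariant ν Lν Hν y
        y-invariant = y-bound , y-support

module Induction (n k : ℕ) (1≤k : 1 ≤ k) (k≤n-1 : k ≤ n ∸ 1) (lam : Vec ℕ k) (young : IsYoung n k lam)
                 (r : ℕ → ℕ → ℕ) (adm : Admissible lam r) where

  open ShapeWeight k r

  k≤n : k ≤ n
  k≤n = ℕP.≤-trans k≤n-1 (ℕP.m∸n≤m n 1)

  rows : ℕ → ℕ
  rows = row lam

  rows-dec : Decreasing rows
  rows-dec {i} {zero}   1≤i i≤0 _ with () ← ℕP.≤-trans 1≤i i≤0
  rows-dec {i} {suc i′} 1≤i i≤1+i′ 1+i′≤k with ℕP.m≤n⇒m<n∨m≡n i≤1+i′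
  ... | inj₂ refl       = ℕP.≤-refl
  ... | inj₁ (s≤s i≤i′) = ℕP.≤-trans (proj₁ young i′ (ℕP.≤-trans 1≤i i≤i′))
                                     (rows-dec 1≤i i≤i′ (ℕP.≤-trans (ℕP.n≤1+n i′) 1+i′≤k))

  rows-outside : ∀ {i} → k < i → rows i ≡ 0
  rows-outside = go lam
    where
    go : ∀ {k} (lam : Vec ℕ k) {i} → k < i → row lam i ≡ 0
    go []          _                  = refl
    go (ℓ ∷ lam) {suc zero}    (s≤s ())
    go (ℓ ∷ lam) {suc (suc i)} (s≤s k<1+i) = go lam k<1+i

  shape : ℕ → ℕ → ℕ → ℕ
  shape i₀ j i = if i <ᵇ i₀ then rows i else (if i ≡ᵇ i₀ then j else 0)

  shape-< : ∀ {i₀ j i} → i < i₀ → shape i₀ j i ≡ rows i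
  shape-< i<i₀ rewrite <ᵇ-true i<i₀ = refl

  shape-≡ : ∀ i₀ j → shape i₀ j i₀ ≡ j
  shape-≡ i₀ j rewrite <ᵇ-false (ℕP.<-irrefl {i₀} refl) | ≡ᵇ-true {i₀} refl = refl

  shape-> : ∀ {i₀ j i} → i₀ < i → shape i₀ j i ≡ 0
  shape-> i₀<i rewrite <ᵇ-false (ℕP.<⇒≯ i₀<i) | ≡ᵇ-false (ℕP.<⇒≢ i₀<i ∘ sym) = refl

  shape-dec : ∀ {i₀ j} → j ≤ rows i₀ → Decreasing (shape i₀ j)
  shape-dec {i₀} {j} j≤row {i} {i′} 1≤i i≤i′ i′≤k with ℕP.<-cmp i′ i₀
  ... | tri< i′<i₀ _ _ rewrite shape-< {j = j} i′<i₀ | shape-< {j = j} (ℕP.≤-<-trans i≤i′ i′<i₀) = rows-dec 1≤i i≤i′ i′≤k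
  ... | tri> _ _ i₀<i′ rewrite shape-> {j = j} i₀<i′ = z≤n
  ... | tri≈ _ refl _ with ℕP.m≤n⇒m<n∨m≡n i≤i′
  ...   | inj₂ refl = ℕP.≤-refl
  ...   | inj₁ i<i₀ rewrite shape-≡ i₀ j | shape-< {j = j} i<i₀ = ℕP.≤-trans j≤row (rows-dec 1≤i (ℕP.<⇒≤ i<i₀) i′≤k)

  shape-grow : ∀ {i₀ j} i → i ≢ i₀ → shape i₀ (suc j) i ≡ shape i₀ j i
  shape-grow {i₀} {j} i i≢i₀ with ℕP.<-cmp i i₀
  ... | tri< i<i₀ _ _ = trans (shape-< i<i₀) (sym (shape-< i<i₀))
  ... | tri≈ _ i≡i₀ _ = ⊥-elim (i≢i₀ i≡i₀)
  ... | tri> _ _ i₀<i = trans (shape-> i₀<i) (sym (shape-> i₀<i))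

  shape-full : ∀ i₀ i → shape i₀ (rows i₀) i ≡ shape (suc i₀) 0 i
  shape-full i₀ i with ℕP.<-cmp i i₀
  ... | tri< i<i₀ _ _ = trans (shape-< i<i₀) (sym (shape-< (ℕP.m<n⇒m<1+n i<i₀)))
  ... | tri≈ _ refl _ = trans (shape-≡ i (rows i)) (sym (shape-< (ℕP.n<1+n i)))
  ... | tri> _ _ i₀<i with ℕP.m≤n⇒m<n∨m≡n i₀<i
  ...   | inj₁ 1+i₀<i = trans (shape-> i₀<i) (sym (shape-> 1+i₀<i))
  ...   | inj₂ refl    = trans (shape-> i₀<i) (sym (shape-≡ (suc i₀) 0))

  shape-empty : ∀ i → shape 1 0 i ≡ 0
  shape-empty zero          = row-zero lam
    where
    row-zero : ∀ {k} (lam : Vec ℕ k) → row lam 0 ≡ 0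
    row-zero []        = refl
    row-zero (ℓ ∷ lam) = refl
  shape-empty (suc zero)    = refl
  shape-empty (suc (suc i)) = refl

  shape-final : ∀ i → shape (suc k) 0 i ≡ rows i
  shape-final i with ℕP.<-cmp i (suc k)
  ... | tri< i<1+k _ _ = shape-< i<1+k
  ... | tri≈ _ refl _  = trans (shape-≡ (suc k) 0) (sym (rows-outside (ℕP.n<1+n k)))
  ... | tri> _ _ 1+k<i = trans (shape-> 1+k<i) (sym (rows-outside (ℕP.<-trans (ℕP.n<1+n k) 1+k<i)))

  InvariantAt : ℕ → ℕ → M n → Set
  InvariantAt i₀ j = Invariant (shape i₀ j) (k ∸ i₀ + (1 ∸ j)) (k + shape i₀ j 1)

  invariant-addBox : ∀ {i₀ j x} → 1 ≤ i₀ → i₀ ≤ k → j < rows i₀ →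
                     InvariantAt i₀ j x → InvariantAt i₀ (suc j) (boxFactor k lam r i₀ (suc j) x)
  invariant-addBox {i₀} {j} {x} 1≤i₀ i₀≤k j<row x-invariant =
    subst (λ q → InvariantAt i₀ (suc j) (λ η → T q x η +F (c *F x η))) (sym (ℕP.+-∸-comm (suc j) i₀≤k))
          Step.y-invariant
    where
    rows-above : ∀ {i} → 1 ≤ i → i < i₀ → suc j ≤ shape i₀ j i
    rows-above 1≤i i<i₀ = subst (suc j ≤_) (sym (shape-< i<i₀)) (ℕP.≤-trans j<row (rows-dec 1≤i (ℕP.<⇒≤ i<i₀) i₀≤k))

    module Box = AddBox 1≤i₀ i₀≤k (shape-dec (ℕP.<⇒≤ j<row)) (shape-dec j<row) (shape-≡ i₀ j) (shape-≡ i₀ (suc j))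
                        shape-grow rows-above shape->

    R : ℕ
    R = rr lam r i₀ (suc j)

    R≡r : R ≡ r i₀ (suc j)
    R≡r = rrRow-inBox 1≤i₀ i₀≤k (s≤s z≤n) j<row

    rrν≡R : rrOf (shape i₀ (suc j)) i₀ (suc j) ≡ R
    rrν≡R = trans (rrRow-inBox 1≤i₀ i₀≤k (s≤s z≤n) (ℕP.≤-reflexive (sym (shape-≡ i₀ (suc j))))) (sym R≡r)

    R<left : 1 ≤ j → R < rrOf (shape i₀ j) i₀ j
    R<left 1≤j = subst (R <_) (sym (rrRow-inBox 1≤i₀ i₀≤k 1≤j (ℕP.≤-reflexive (sym (shape-≡ i₀ j)))))
                       (proj₁ (proj₂ (adm i₀ j (1≤i₀ , i₀≤k , 1≤j , ℕP.<⇒≤ j<row))))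

    R<above : ∀ {i′} → i₀ ≡ suc i′ → 1 ≤ i′ → R < rrOf (shape i₀ j) i′ (suc j)
    R<above {i′} refl 1≤i′ =
      subst (R <_) (sym (rrRow-inBox 1≤i′ (ℕP.<⇒≤ i₀≤k) (s≤s z≤n) (rows-above 1≤i′ (ℕP.n<1+n i′))))
        (proj₂ (proj₂ (adm i′ (suc j) (1≤i′ , ℕP.<⇒≤ i₀≤k , s≤s z≤n ,
                                        ℕP.≤-trans j<row (rows-dec 1≤i′ (ℕP.n≤1+n i′) i₀≤k)))))

    c : Qv
    c = -F (vpow R ÷F qint R)

    c-order : Ord≥ (boxOrder R) c
    c-order = Ord≥-neg _ (Ord≥-v^r/[r] R
                (subst (1 ≤_) (sym R≡r) (proj₁ (adm i₀ (suc j) (1≤i₀ , i₀≤k , s≤s z≤n , j<row)))))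

    1+p≤n : suc Box.p ≤ n
    1+p≤n = begin
      suc (k ∸ i₀ + suc j)        ≤⟨ s≤s (ℕP.+-mono-≤ (ℕP.∸-monoʳ-≤ k 1≤i₀) (ℕP.≤-trans j<row (proj₂ young i₀))) ⟩
      suc (k ∸ 1 + (n ∸ k))       ≡⟨ cong (_+ (n ∸ k)) (trans (ℕP.+-comm 1 (k ∸ 1)) (ℕP.m∸n+n≡m 1≤k)) ⟩
      k + (n ∸ k)                 ≡⟨ ℕP.m+[n∸m]≡n k≤n ⟩
      n                           ∎
      where open ℕP.≤-Reasoning

    module Step = Box.Valuation 1+p≤n R rrν≡R R<left R<above c c-order x x-invariant

  -- after the first i rows, the k ∸ i untouched rows keep their pluses at 1, …, k ∸ i
  InvariantAfter : ℕ → M n → Set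
  InvariantAfter i = Invariant (shape (suc i) 0) (k ∸ i) (k + shape (suc i) 0 1)

  invariant-row : ∀ {i x} → i < k → InvariantAfter i x → InvariantAfter (suc i) (rowAct k lam r (suc i) x)
  invariant-row {i} {x} i<k x-invariant =
    invariant-transport (shape-full (suc i)) (ℕP.m≤m+n (k ∸ suc i) _)
                        (ℕP.≤-reflexive (cong (λ z → k + z) (shape-full (suc i) 1)))
      (foldl-oneTo-induction (InvariantAt (suc i)) (λ y j → boxFactor k lam r (suc i) j y) (rows (suc i))
        (invariant-transport (λ _ → refl) (ℕP.≤-reflexive (trans (ℕP.+-comm (k ∸ suc i) 1) (sym (ℕP.+-∸-assoc 1 i<k))))
                             ℕP.≤-refl x-invariant)
        (λ j j<row → invariant-addBox (s≤s z≤n) i<k j<row))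

  invariant-initial : InvariantAfter 0 (oneM n k)
  invariant-initial = bound , support
    where
    bound : ∀ η → Ord≥ (weightOf (shape 1 0) η) (oneM n k η)
    bound η with eqVec η (oneVec n k)
    ... | true  = Ord≥-mono 1F (ℤP.≤-trans (ℤP.≤-reflexive (weightOf-cong shape-empty η)) (weightOf-empty η)) Ord≥-1F
    ... | false = vanishing (λ _ → refl)
    support : ∀ η → Violates k (k + 0) η → IsZero (oneM n k η)
    support η violation with eqVec η (oneVec n k) in η≟1
    ... | true  = ⊥-elim (oneVec-no-violation k≤n (subst (Violates k (k + 0)) (eqVec-sound η (oneVec n k) η≟1) violation))
    ... | false = λ _ → refl

  X·1-bound : ∀ ε → Ord≥ (weight lam r ε) (XAct k lam r (oneM n k) ε)
  X·1-bound ε = subst (λ m → Ord≥ m (XAct k lam r (oneM n k) ε)) (weightOf-cong shape-final ε)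
    (proj₁ (foldl-oneTo-induction InvariantAfter (λ y i → rowAct k lam r i y) k invariant-initial
              (λ i i<k → invariant-row i<k))
           ε)

-- The bound holds for every sign vector.
lemma3p1 : (n k : ℕ) → 1 ≤ k → k ≤ n ∸ 1 →
           (lam : Vec ℕ k) → IsYoung n k lam →
           (r : ℕ → ℕ → ℕ) → Admissible lam r →
           (ε : Vec Bool n) → InE n k ε →
           InO (weight lam r ε) (XAct k lam r (oneM n k) ε)
lemma3p1 n k 1≤k k≤n-1 lam young r adm ε _ =
  Ord≥⇒InO (weight lam r ε) (XAct k lam r (oneM n k) ε) (Induction.X·1-bound n k 1≤k k≤n-1 lam young r adm ε)
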